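{- If every typable term of the $\overline{\lambda}\mu\tilde{\mu}^*$-calculus is strongly normalizing with respect to $\hookrightarrow$, then every typable term of $\lambda^{Sym}_{Prop}$ is strongly normalizing with respect to $\to$.
   Context: $\overline{\lambda}\mu\tilde{\mu}^*$: $p::=\lfloor t,e\rfloor$; $t::=x\mid\lambda x\,t\mid\mu\alpha\,p\mid\overline{e}$; $e::=\alpha\mid(t.e)\mid\tilde{\mu}x\,p\mid\widetilde{t}$; types from atomic types by $\to$ and $(\cdot)^\bot$ modulo $(A^\bot)^\bot=A$; typing judgments $\Gamma\rhd t:A\mid\Delta$, $\Gamma\mid e:A\rhd\Delta$, $p:(\Gamma\rhd\Delta)$ given by: $\Gamma,x:A\rhd x:A\mid\Delta$; $\Gamma\mid\alpha:A\rhd\alpha:A,\Delta$; $\lambda x\,t:A\to B$ from $\Gamma,x:A\rhd t:B\mid\Delta$; $(t.e):A\to B$ from $t:A$, $e:B$; $\lfloor t,e\rfloor:(\Gamma\rhd\Delta)$ from $t:A$, $e:A$; $\mu\alpha\,p:A$ from $p:(\Gamma\rhd\alpha:A,\Delta)$; $\tilde\mu x\,p:A$ from $p:(\Gamma,x:A\rhd\Delta)$; $\overline e:A^\bot$ from $e:A$; $\widetilde t:A^\bot$ from $t:A$. $\hookrightarrow$ is the compatible closure of $\lfloor\lambda x\,t,(t'.e)\rfloor\hookrightarrow\lfloor t',\tilde{\mu}x\lfloor t,e\rfloor\rfloor$, $\lfloor\mu\alpha\,p,e\rfloor\hookrightarrow p[\alpha:=e]$, $\lfloor t,\tilde{\mu}x\,p\rfloor\hookrightarrow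 p[x:=t]$, $\mu\alpha\lfloor t,\alpha\rfloor\hookrightarrow t$ ($\alpha\notin Fv(t)$), $\tilde{\mu}x\lfloor x,e\rfloor\hookrightarrow e$ ($x\notin Fv(e)$), $\overline{\widetilde{t}}\hookrightarrow t$, $\widetilde{\overline{e}}\hookrightarrow e$, $\lfloor\overline{e},\widetilde{t}\rfloor\hookrightarrow\lfloor t,e\rfloor$. $\lambda^{Sym}_{Prop}$: m-types $A::=\alpha\mid\alpha^\bot\mid A\wedge A\mid A\vee A$, types m-types or $\bot$, involutive negation $(\alpha)^\bot=\alpha^\bot$, $(\alpha^\bot)^\bot=\alpha$, $(A\wedge B)^\bot=A^\bot\vee B^\bot$, $(A\vee B)^\bot=A^\bot\wedge B^\bot$; typing $\Gamma,x:A\vdash x:A$; $\langle P_1,P_2\rangle:A_1\wedge A_2$; $\sigma_i(P_i):A_1\vee A_2$; $\lambda xP:A^\bot$ from $\Gamma,x:A\vdash P:\bot$; $(P_1\star P_2):\bot$ from $P_1:A^\bot,P_2:A$. $\to$ is the compatible closure of: $(\lambda xP\star Q)\to P[x:=Q]$; $(Q\star\lambda xP)\to P[x:=Q]$; $\lambda x(P\star x)\to P$, $\lambda x(x\star P)\to P$ ($x\notin Fv(P)$); $(\langle P_1,P_2\rangle\star\sigma_i(Q))\to(P_i\star Q)$; $(\sigma_i(Q)\star\langle P_1,P_2\rangle)\to(Q\star P_i)$; $E[P]\to P$ for one-hole contexts $E[-]\neq[-]$ of type $\bot$ with $P:\bot$ and no free variable of $P$ bound by $E$. -}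

module Defs where

open import Data.Nat using (ℕ; zero; suc)
open import Data.Fin using (Fin; zero; suc)
open import Data.Vec using (Vec; []; _∷_; lookup)
open import Relation.Nullary using (¬_)
open import Induction.WellFounded using (Acc)

-- The calculus  λ̄μμ̃*  (scoped de Bruijn syntax: n term variables,
-- m co-variables; index zero = most recently bound variable)

module LMM where

  -- Types: built from atomic types by → and (·)^⊥, modulo (A^⊥)^⊥ = A.
  -- We use canonical representatives: a type is a "pre-type" (atomic or
  -- arrow) carrying a polarity; ^⊥ flips the polarity.  This is exactly
  -- the quotient of the free syntax by (A^⊥)^⊥ = A.
  data Ty  : Set
  data Pre : Set

  data Ty where
    pos : Pre → Ty
    neg : Pre → Ty

  data Pre where
    atom : ℕ → Pre
    _⇒_  : Ty → Ty → Pre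

  at : ℕ → Ty
  at k = pos (atom k)

  _⟶_ : Ty → Ty → Ty
  A ⟶ B = pos (A ⇒ B)

  dual : Ty → Ty
  dual (pos P) = neg P
  dual (neg P) = pos P

  data Cmd  (n m : ℕ) : Set
  data Tm   (n m : ℕ) : Set
  data CoTm (n m : ℕ) : Set

  data Cmd n m where
    ⌊_,_⌋ : Tm n m → CoTm n m → Cmd n m

  data Tm n m where
    var : Fin n → Tm n m
    lam : Tm (suc n) m → Tm n m
    mu  : Cmd n (suc m) → Tm n m
    bar : CoTm n m → Tm n m

  data CoTm n m where
    covar : Fin m → CoTm n m
    _·_   : Tm n m → CoTm n m → CoTm n m
    mut   : Cmd (suc n) m → CoTm n m
    tld   : Tm n m → CoTm n m

  ext : ∀ {n n'} → (Fin n → Fin n') → Fin (suc n) → Fin (suc n')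
  ext ρ zero    = zero
  ext ρ (suc i) = suc (ρ (i))

  renC : ∀ {n m n' m'} → (Fin n → Fin n') → (Fin m → Fin m') → Cmd n m → Cmd n' m'
  renT : ∀ {n m n' m'} → (Fin n → Fin n') → (Fin m → Fin m') → Tm n m → Tm n' m'
  renE : ∀ {n m n' m'} → (Fin n → Fin n') → (Fin m → Fin m') → CoTm n m → CoTm n' m'

  renC ρ ϱ ⌊ t , e ⌋ = ⌊ renT ρ ϱ t , renE ρ ϱ e ⌋

  renT ρ ϱ (var x) = var (ρ x)
  renT ρ ϱ (lam t) = lam (renT (ext ρ) ϱ t)
  renT ρ ϱ (mu p)  = mu (renC ρ (ext ϱ) p)
  renT ρ ϱ (bar e) = bar (renE ρ ϱ e)

  renE ρ ϱ (covar α) = covar (ϱ α)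
  renE ρ ϱ (t · e)   = renT ρ ϱ t · renE ρ ϱ e
  renE ρ ϱ (mut p)   = mut (renC (ext ρ) ϱ p)
  renE ρ ϱ (tld t)   = tld (renT ρ ϱ t)

  wkTx : ∀ {n m} → Tm n m → Tm (suc n) m
  wkTx = renT suc (λ α → α)

  wkTα : ∀ {n m} → Tm n m → Tm n (suc m)
  wkTα = renT (λ x → x) suc

  wkEx : ∀ {n m} → CoTm n m → CoTm (suc n) m
  wkEx = renE suc (λ α → α)

  wkEα : ∀ {n m} → CoTm n m → CoTm n (suc m)
  wkEα = renE (λ x → x) suc

  liftx : ∀ {n n' m'} → (Fin n → Tm n' m') → Fin (suc n) → Tm (suc n') m'
  liftx {n' = n'} {m'} σ zero    = var zero
  liftx {n' = n'} {m'} σ (suc i) = wkTx {n'} {m'} (σ i)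

  liftα : ∀ {m n' m'} → (Fin m → CoTm n' m') → Fin (suc m) → CoTm n' (suc m')
  liftα {n' = n'} {m'} τ zero    = covar zero
  liftα {n' = n'} {m'} τ (suc j) = wkEα {n'} {m'} (τ j)

  subC : ∀ {n m n' m'} → (Fin n → Tm n' m') → (Fin m → CoTm n' m') → Cmd n m → Cmd n' m'
  subT : ∀ {n m n' m'} → (Fin n → Tm n' m') → (Fin m → CoTm n' m') → Tm n m → Tm n' m'
  subE : ∀ {n m n' m'} → (Fin n → Tm n' m') → (Fin m → CoTm n' m') → CoTm n m → CoTm n' m'

  subC σ τ ⌊ t , e ⌋ = ⌊ subT σ τ t , subE σ τ e ⌋

  subT σ τ (var x) = σ x
  subT {n' = n'} {m'} σ τ (lam t) = lam (subT (liftx σ) (λ j → wkEx {n'} {m'} (τ j)) t)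
  subT {n' = n'} {m'} σ τ (mu p)  = mu (subC (λ i → wkTα {n'} {m'} (σ i)) (liftα τ) p)
  subT σ τ (bar e) = bar (subE σ τ e)

  subE σ τ (covar α) = τ α
  subE σ τ (t · e)   = subT σ τ t · subE σ τ e
  subE {n' = n'} {m'} σ τ (mut p)   = mut (subC (liftx σ) (λ j → wkEx {n'} {m'} (τ j)) p)
  subE σ τ (tld t)   = tld (subT σ τ t)

  _[x≔_] : ∀ {n m} → Cmd (suc n) m → Tm n m → Cmd n m
  p [x≔ t ] = subC σ covar p
    where
    σ : Fin _ → Tm _ _
    σ zero    = t
    σ (suc i) = var i

  _[α≔_] : ∀ {n m} → Cmd n (suc m) → CoTm n m → Cmd n m
  p [α≔ e ] = subC var τ p
    where
    τ : Fin _ → CoTm _ _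
    τ zero    = e
    τ (suc j) = covar j

  -- Typing:  ⊢T Γ Δ t A  is  Γ ▷ t : A ∣ Δ ;  ⊢E Γ Δ e A  is  Γ ∣ e : A ▷ Δ ;
  --          ⊢C Γ Δ p    is  p : (Γ ▷ Δ)
  data ⊢C {n m} (Γ : Vec Ty n) (Δ : Vec Ty m) : Cmd n m → Set
  data ⊢T {n m} (Γ : Vec Ty n) (Δ : Vec Ty m) : Tm n m → Ty → Set
  data ⊢E {n m} (Γ : Vec Ty n) (Δ : Vec Ty m) : CoTm n m → Ty → Set

  data ⊢C {n} {m} Γ Δ where
    cut : ∀ {t e A} → ⊢T Γ Δ t A → ⊢E Γ Δ e A → ⊢C Γ Δ ⌊ t , e ⌋

  data ⊢T {n} {m} Γ Δ where
    ax  : ∀ x → ⊢T Γ Δ (var x) (lookup Γ x)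
    lam : ∀ {t A B} → ⊢T (A ∷ Γ) Δ t B → ⊢T Γ Δ (lam t) (A ⟶ B)
    mu  : ∀ {p A} → ⊢C Γ (A ∷ Δ) p → ⊢T Γ Δ (mu p) A
    bar : ∀ {e A} → ⊢E Γ Δ e A → ⊢T Γ Δ (bar e) (dual A)

  data ⊢E {n} {m} Γ Δ where
    ax  : ∀ α → ⊢E Γ Δ (covar α) (lookup Δ α)
    app : ∀ {t e A B} → ⊢T Γ Δ t A → ⊢E Γ Δ e B → ⊢E Γ Δ (t · e) (A ⟶ B)
    mut : ∀ {p A} → ⊢C (A ∷ Γ) Δ p → ⊢E Γ Δ (mut p) A
    tld : ∀ {t A} → ⊢T Γ Δ t A → ⊢E Γ Δ (tld t) (dual A)

  data _↪C_ {n m} : Cmd n m → Cmd n m → Set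
  data _↪T_ {n m} : Tm n m → Tm n m → Set
  data _↪E_ {n m} : CoTm n m → CoTm n m → Set

  data _↪C_ {n} {m} where
    βλ   : ∀ t t' e → ⌊ lam t , t' · e ⌋ ↪C ⌊ t' , mut ⌊ t , wkEx e ⌋ ⌋
    βμ   : ∀ p e → ⌊ mu p , e ⌋ ↪C (p [α≔ e ])
    βμ̃   : ∀ t p → ⌊ t , mut p ⌋ ↪C (p [x≔ t ])
    βbt  : ∀ e t → ⌊ bar e , tld t ⌋ ↪C ⌊ t , e ⌋
    cutˡ : ∀ {t t'} e → t ↪T t' → ⌊ t , e ⌋ ↪C ⌊ t' , e ⌋
    cutʳ : ∀ t {e e'} → e ↪E e' → ⌊ t , e ⌋ ↪C ⌊ t , e' ⌋

  data _↪T_ {n} {m} where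
    -- μα⌊t,α⌋ ↪ t   (α ∉ Fv(t))
    ημ   : ∀ t → mu ⌊ wkTα t , covar zero ⌋ ↪T t
    bartld : ∀ t → bar (tld t) ↪T t
    lamc : ∀ {t t'} → t ↪T t' → lam t ↪T lam t'
    muc  : ∀ {p p'} → p ↪C p' → mu p ↪T mu p'
    barc : ∀ {e e'} → e ↪E e' → bar e ↪T bar e'

  data _↪E_ {n} {m} where
    -- μ̃x⌊x,e⌋ ↪ e   (x ∉ Fv(e))
    ημ̃   : ∀ e → mut ⌊ var zero , wkEx e ⌋ ↪E e
    tldbar : ∀ e → tld (bar e) ↪E e
    appˡ : ∀ {t t'} e → t ↪T t' → (t · e) ↪E (t' · e)
    appʳ : ∀ t {e e'} → e ↪E e' → (t · e) ↪E (t · e')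
    mutc : ∀ {p p'} → p ↪C p' → mut p ↪E mut p'
    tldc : ∀ {t t'} → t ↪T t' → tld t ↪E tld t'

  SNC : ∀ {n m} → Cmd n m → Set
  SNC = Acc (λ q p → p ↪C q)

  SNT : ∀ {n m} → Tm n m → Set
  SNT = Acc (λ u t → t ↪T u)

  SNE : ∀ {n m} → CoTm n m → Set
  SNE = Acc (λ f e → e ↪E f)

  AllTypableSN : Set
  AllTypableSN =
    (∀ {n m} (Γ : Vec Ty n) (Δ : Vec Ty m) (p : Cmd n m) → ⊢C Γ Δ p → SNC p)
    × ((∀ {n m} (Γ : Vec Ty n) (Δ : Vec Ty m) (t : Tm n m) (A : Ty) → ⊢T Γ Δ t A → SNT t)
    × (∀ {n m} (Γ : Vec Ty n) (Δ : Vec Ty m) (e : CoTm n m) (A : Ty) → ⊢E Γ Δ e A → SNE e))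
    where open import Data.Product using (_×_)

module Sym where

  data MTy : Set where
    at   : ℕ → MTy
    coat : ℕ → MTy
    _∧_  : MTy → MTy → MTy
    _∨_  : MTy → MTy → MTy

  data STy : Set where
    m   : MTy → STy
    bot : STy

  neg : MTy → MTy
  neg (at k)   = coat k
  neg (coat k) = at k
  neg (A ∧ B)  = neg A ∨ neg B
  neg (A ∨ B)  = neg A ∧ neg B

  data Tm (n : ℕ) : Set where
    var  : Fin n → Tm n
    pair : Tm n → Tm n → Tm n
    σ₁   : Tm n → Tm n
    σ₂   : Tm n → Tm n
    lam  : Tm (suc n) → Tm n
    _⋆_  : Tm n → Tm n → Tm n

  ext : ∀ {n n'} → (Fin n → Fin n') → Fin (suc n) → Fin (suc n')
  ext ρ zero    = zero
  ext ρ (suc i) = suc (ρ i)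

  ren : ∀ {n n'} → (Fin n → Fin n') → Tm n → Tm n'
  ren ρ (var x)    = var (ρ x)
  ren ρ (pair P Q) = pair (ren ρ P) (ren ρ Q)
  ren ρ (σ₁ P)     = σ₁ (ren ρ P)
  ren ρ (σ₂ P)     = σ₂ (ren ρ P)
  ren ρ (lam P)    = lam (ren (ext ρ) P)
  ren ρ (P ⋆ Q)    = ren ρ P ⋆ ren ρ Q

  wk : ∀ {n} → Tm n → Tm (suc n)
  wk = ren suc

  lift : ∀ {n n'} → (Fin n → Tm n') → Fin (suc n) → Tm (suc n')
  lift σ zero    = var zero
  lift σ (suc i) = wk (σ i)

  sub : ∀ {n n'} → (Fin n → Tm n') → Tm n → Tm n'
  sub σ (var x)    = σ x
  sub σ (pair P Q) = pair (sub σ P) (sub σ Q)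
  sub σ (σ₁ P)     = σ₁ (sub σ P)
  sub σ (σ₂ P)     = σ₂ (sub σ P)
  sub σ (lam P)    = lam (sub (lift σ) P)
  sub σ (P ⋆ Q)    = sub σ P ⋆ sub σ Q

  _[≔_] : ∀ {n} → Tm (suc n) → Tm n → Tm n
  P [≔ Q ] = sub σ P
    where
    σ : Fin _ → Tm _
    σ zero    = Q
    σ (suc i) = var i

  data _⊢_∶_ {n} (Γ : Vec MTy n) : Tm n → STy → Set where
    ax   : ∀ x → Γ ⊢ var x ∶ m (lookup Γ x)
    pair : ∀ {P₁ P₂ A₁ A₂} → Γ ⊢ P₁ ∶ m A₁ → Γ ⊢ P₂ ∶ m A₂ → Γ ⊢ pair P₁ P₂ ∶ m (A₁ ∧ A₂)
    inj₁ : ∀ {P A₁ A₂} → Γ ⊢ P ∶ m A₁ → Γ ⊢ σ₁ P ∶ m (A₁ ∨ A₂)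
    inj₂ : ∀ {P A₁ A₂} → Γ ⊢ P ∶ m A₂ → Γ ⊢ σ₂ P ∶ m (A₁ ∨ A₂)
    lam  : ∀ {P A} → (A ∷ Γ) ⊢ P ∶ bot → Γ ⊢ lam P ∶ m (neg A)
    star : ∀ {P₁ P₂ A} → Γ ⊢ P₁ ∶ m (neg A) → Γ ⊢ P₂ ∶ m A → Γ ⊢ (P₁ ⋆ P₂) ∶ bot

  -- One-hole contexts E[-]: outer scope n, hole scope k
  data Ctx (n : ℕ) : ℕ → Set where
    hole  : Ctx n n
    pairˡ : ∀ {k} → Ctx n k → Tm n → Ctx n k
    pairʳ : ∀ {k} → Tm n → Ctx n k → Ctx n k
    σ₁c   : ∀ {k} → Ctx n k → Ctx n k
    σ₂c   : ∀ {k} → Ctx n k → Ctx n k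
    lamc  : ∀ {k} → Ctx (suc n) k → Ctx n k
    starˡ : ∀ {k} → Ctx n k → Tm n → Ctx n k
    starʳ : ∀ {k} → Tm n → Ctx n k → Ctx n k

  plug : ∀ {n k} → Ctx n k → Tm k → Tm n
  plug hole        P = P
  plug (pairˡ E Q) P = pair (plug E P) Q
  plug (pairʳ Q E) P = pair Q (plug E P)
  plug (σ₁c E)     P = σ₁ (plug E P)
  plug (σ₂c E)     P = σ₂ (plug E P)
  plug (lamc E)    P = lam (plug E P)
  plug (starˡ E Q) P = plug E P ⋆ Q
  plug (starʳ Q E) P = Q ⋆ plug E P

  -- embedding of the outer variables into the hole's scope
  -- (a term of the form  ren (ctxRen E) P  has no free variable bound by E)
  ctxRen : ∀ {n k} → Ctx n k → Fin n → Fin k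
  ctxRen hole        = λ i → i
  ctxRen (pairˡ E _) = ctxRen E
  ctxRen (pairʳ _ E) = ctxRen E
  ctxRen (σ₁c E)     = ctxRen E
  ctxRen (σ₂c E)     = ctxRen E
  ctxRen (lamc E)    = λ i → ctxRen E (suc i)
  ctxRen (starˡ E _) = ctxRen E
  ctxRen (starʳ _ E) = ctxRen E

  data IsHole {n} : ∀ {k} → Ctx n k → Set where
    hole : IsHole hole

  data _⟶_ {n} : Tm n → Tm n → Set where
    βˡ   : ∀ P Q → (lam P ⋆ Q) ⟶ (P [≔ Q ])
    βʳ   : ∀ P Q → (Q ⋆ lam P) ⟶ (P [≔ Q ])
    ηˡ   : ∀ P → lam (wk P ⋆ var zero) ⟶ P
    ηʳ   : ∀ P → lam (var zero ⋆ wk P) ⟶ P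
    π₁ˡ  : ∀ P₁ P₂ Q → (pair P₁ P₂ ⋆ σ₁ Q) ⟶ (P₁ ⋆ Q)
    π₂ˡ  : ∀ P₁ P₂ Q → (pair P₁ P₂ ⋆ σ₂ Q) ⟶ (P₂ ⋆ Q)
    π₁ʳ  : ∀ P₁ P₂ Q → (σ₁ Q ⋆ pair P₁ P₂) ⟶ (Q ⋆ P₁)
    π₂ʳ  : ∀ P₁ P₂ Q → (σ₂ Q ⋆ pair P₁ P₂) ⟶ (Q ⋆ P₂)
    ⊥-red : ∀ {k} (E : Ctx n k) (P : Tm n) (Γ : Vec MTy n) → ¬ IsHole E
          → Γ ⊢ plug E (ren (ctxRen E) P) ∶ bot → Γ ⊢ P ∶ bot
          → plug E (ren (ctxRen E) P) ⟶ P
    pairˡ : ∀ {P P'} Q → P ⟶ P' → pair P Q ⟶ pair P' Q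
    pairʳ : ∀ P {Q Q'} → Q ⟶ Q' → pair P Q ⟶ pair P Q'
    σ₁c   : ∀ {P P'} → P ⟶ P' → σ₁ P ⟶ σ₁ P'
    σ₂c   : ∀ {P P'} → P ⟶ P' → σ₂ P ⟶ σ₂ P'
    lamc  : ∀ {P P'} → P ⟶ P' → lam P ⟶ lam P'
    starˡ : ∀ {P P'} Q → P ⟶ P' → (P ⋆ Q) ⟶ (P' ⋆ Q)
    starʳ : ∀ P {Q Q'} → Q ⟶ Q' → (P ⋆ Q) ⟶ (P ⋆ Q')

  SN : ∀ {n} → Tm n → Set
  SN = Acc (λ Q P → P ⟶ Q)

  AllTypableSN : Set
  AllTypableSN = ∀ {n} (Γ : Vec MTy n) (P : Tm n) (T : STy) → Γ ⊢ P ∶ T → SN P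

module Submission where

-- Reduction ⟶ of λSym is split into logical steps →R (β and π) and
-- structural steps →S (η and the ⊥-rule E[P] → P).
--  * Logical steps are simulated: a typed λSym term has a typed translation
--    into λ̄μμ̃*, and each logical step is matched by at least one ↪-step
--    between translations.  Hence typable λSym terms are strongly normalizing
--    for →R.
--  * Structural steps decrease the size of terms, and on typed terms a
--    structural step followed by a logical step can be replaced by a logical
--    step followed by ⟶-steps, up to the equivalence ≋ that swaps the two
--    arguments of ⋆ (a strong bisimulation for ⟶).

open import Data.Nat using (ℕ; zero; suc; _+_; _<_; _≤_; s≤s)
open import Data.Nat.Properties using (≤-refl; ≤-trans; <-≤-trans; ≤-pred; ≤-reflexive; m≤m+n; m≤n+m; n≤1+n; +-monoˡ-<; +-monoʳ-<; <⇒≤)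
open import Data.Fin using (Fin; zero; suc)
open import Data.Vec using (Vec; []; _∷_; lookup; map)
open import Data.Vec.Properties using (lookup-map)
open import Data.Product using (∃; ∃₂; _×_; _,_)
open import Data.Sum using (_⊎_; inj₁; inj₂; [_,_]′)
import Data.Sum as Sum
open import Data.Empty using (⊥-elim)
open import Relation.Nullary using (¬_)
open import Induction.WellFounded using (Acc; acc)
open import Relation.Binary.Construct.Closure.ReflexiveTransitive using (Star; ε; _◅_; _◅◅_; gmap; return)
open import Relation.Binary.Construct.Closure.Transitive using (TransClosure; [_]; _∷_; _∷ʳ_; accessible)
open import Relation.Binary.PropositionalEquality
open import Defs

module Postponement
  {A : Set} (Inv : A → Set)
  (_⟶_ _→R_ _→S_ _≈_ : A → A → Set)
  (size : A → ℕ)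
  (split   : ∀ {x y} → x ⟶ y → (x →R y) ⊎ (x →S y))
  (R-inv   : ∀ {x y} → Inv x → x →R y → Inv y)
  (S-inv   : ∀ {x y} → Inv x → x →S y → Inv y)
  (S-size  : ∀ {x y} → x →S y → size y < size x)
  (≈-refl  : ∀ {x} → x ≈ x)
  (≈-trans : ∀ {x y z} → x ≈ y → y ≈ z → x ≈ z)
  (bisim   : ∀ {x x' y} → x ≈ x' → x ⟶ y → ∃ λ y' → (x' ⟶ y') × (y ≈ y'))
  (commute : ∀ {x y z} → Inv x → x →S y → y →R z →
             ∃₂ λ w z' → (x →R w) × Star _⟶_ w z' × (z ≈ z'))
  where

  SN : A → Set
  SN = Acc (λ y x → x ⟶ y)

  AccR : A → Set
  AccR = Acc (λ y x → x →R y)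

  bisim* : ∀ {x x' y} → x ≈ x' → Star _⟶_ x y → ∃ λ y' → Star _⟶_ x' y' × (y ≈ y')
  bisim* x≈x' ε = _ , ε , x≈x'
  bisim* x≈x' (x⟶y ◅ y⟶*z) with bisim x≈x' x⟶y
  ... | y' , x'⟶y' , y≈y' with bisim* y≈y' y⟶*z
  ... | z' , y'⟶*z' , z≈z' = z' , x'⟶y' ◅ y'⟶*z' , z≈z'

  SN-≈ : ∀ {x x'} → x ≈ x' → SN x' → SN x
  SN-≈ x≈x' (acc rs) = acc λ x⟶y → let (y' , x'⟶y' , y≈y') = bisim x≈x' x⟶y in SN-≈ y≈y' (rs x'⟶y')

  SN-⟶* : ∀ {x y} → Star _⟶_ x y → SN x → SN y
  SN-⟶* ε sn = sn
  SN-⟶* (x⟶y ◅ y⟶*z) (acc rs) = SN-⟶* y⟶*z (rs x⟶y)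

  postpone : ∀ {x y z} → Inv x → Star _→S_ x y → y →R z →
             ∃₂ λ w z' → (x →R w) × Star _⟶_ w z' × (z ≈ z')
  postpone ix ε y→Rz = _ , _ , y→Rz , ε , ≈-refl
  postpone ix (x→Sx₁ ◅ x₁→S*y) y→Rz with postpone (S-inv ix x→Sx₁) x₁→S*y y→Rz
  ... | w₁ , z₁ , x₁→Rw₁ , w₁⟶*z₁ , z≈z₁ with commute ix x→Sx₁ x₁→Rw₁
  ... | w , w₁' , x→Rw , w⟶*w₁' , w₁≈w₁' with bisim* w₁≈w₁' w₁⟶*z₁
  ... | z' , w₁'⟶*z' , z₁≈z' = w , z' , x→Rw , w⟶*w₁' ◅◅ w₁'⟶*z' , ≈-trans z≈z₁ z₁≈z'

  -- Every structural reduct y of x with size y < k is strongly normalizing;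
  -- by induction on the logical accessibility of x, then on k.
  SN-below : ∀ {x} → AccR x → Inv x → ∀ k {y} → size y < k → Star _→S_ x y → SN y
  SN-below _ _ zero () _
  SN-below (acc rs) ix (suc k) y<k x→S*y = acc λ y⟶v → [
      (λ y→Rv → let (w , v' , x→Rw , w⟶*v' , v≈v') = postpone ix x→S*y y→Rv in
        SN-≈ v≈v' (SN-⟶* w⟶*v' (SN-below (rs x→Rw) (R-inv ix x→Rw) (suc (size w)) ≤-refl ε))) ,
      (λ y→Sv → SN-below (acc rs) ix k (<-≤-trans (S-size y→Sv) (≤-pred y<k)) (x→S*y ◅◅ return y→Sv)) ]′
    (split y⟶v)

  SN-from-logical : ∀ {x} → Inv x → AccR x → SN x
  SN-from-logical ix accR = SN-below accR ix (suc (size _)) ≤-refl ε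

module SymSubstitution where
  open Sym

  ext-cong : ∀ {n n'} {ρ ρ' : Fin n → Fin n'} → (∀ i → ρ i ≡ ρ' i) → ∀ i → ext ρ i ≡ ext ρ' i
  ext-cong eq zero    = refl
  ext-cong eq (suc i) = cong suc (eq i)

  ren-cong : ∀ {n n'} {ρ ρ' : Fin n → Fin n'} → (∀ i → ρ i ≡ ρ' i) → ∀ P → ren ρ P ≡ ren ρ' P
  ren-cong eq (var x)    = cong var (eq x)
  ren-cong eq (pair P Q) = cong₂ pair (ren-cong eq P) (ren-cong eq Q)
  ren-cong eq (σ₁ P)     = cong σ₁ (ren-cong eq P)
  ren-cong eq (σ₂ P)     = cong σ₂ (ren-cong eq P)
  ren-cong eq (lam P)    = cong lam (ren-cong (ext-cong eq) P)
  ren-cong eq (P ⋆ Q)    = cong₂ _⋆_ (ren-cong eq P) (ren-cong eq Q)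

  ren-ren : ∀ {n n' n''} (ρ : Fin n' → Fin n'') (ρ' : Fin n → Fin n') P →
            ren ρ (ren ρ' P) ≡ ren (λ i → ρ (ρ' i)) P
  ren-ren ρ ρ' (var x)    = refl
  ren-ren ρ ρ' (pair P Q) = cong₂ pair (ren-ren ρ ρ' P) (ren-ren ρ ρ' Q)
  ren-ren ρ ρ' (σ₁ P)     = cong σ₁ (ren-ren ρ ρ' P)
  ren-ren ρ ρ' (σ₂ P)     = cong σ₂ (ren-ren ρ ρ' P)
  ren-ren ρ ρ' (lam P)    =
    cong lam (trans (ren-ren (ext ρ) (ext ρ') P) (ren-cong (λ { zero → refl ; (suc i) → refl }) P))
  ren-ren ρ ρ' (P ⋆ Q)    = cong₂ _⋆_ (ren-ren ρ ρ' P) (ren-ren ρ ρ' Q)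

  ren-id : ∀ {n} {ρ : Fin n → Fin n} → (∀ i → ρ i ≡ i) → ∀ P → ren ρ P ≡ P
  ren-id eq (var x)    = cong var (eq x)
  ren-id eq (pair P Q) = cong₂ pair (ren-id eq P) (ren-id eq Q)
  ren-id eq (σ₁ P)     = cong σ₁ (ren-id eq P)
  ren-id eq (σ₂ P)     = cong σ₂ (ren-id eq P)
  ren-id eq (lam P)    = cong lam (ren-id (λ { zero → refl ; (suc i) → cong suc (eq i) }) P)
  ren-id eq (P ⋆ Q)    = cong₂ _⋆_ (ren-id eq P) (ren-id eq Q)

  ren-ext-wk : ∀ {n n'} (ρ : Fin n → Fin n') P → ren (ext ρ) (wk P) ≡ wk (ren ρ P)
  ren-ext-wk ρ P = trans (ren-ren (ext ρ) suc P) (sym (ren-ren suc ρ P))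

  lift-cong : ∀ {n n'} {σ σ' : Fin n → Tm n'} → (∀ i → σ i ≡ σ' i) → ∀ i → lift σ i ≡ lift σ' i
  lift-cong eq zero    = refl
  lift-cong eq (suc i) = cong wk (eq i)

  sub-cong : ∀ {n n'} {σ σ' : Fin n → Tm n'} → (∀ i → σ i ≡ σ' i) → ∀ P → sub σ P ≡ sub σ' P
  sub-cong eq (var x)    = eq x
  sub-cong eq (pair P Q) = cong₂ pair (sub-cong eq P) (sub-cong eq Q)
  sub-cong eq (σ₁ P)     = cong σ₁ (sub-cong eq P)
  sub-cong eq (σ₂ P)     = cong σ₂ (sub-cong eq P)
  sub-cong eq (lam P)    = cong lam (sub-cong (lift-cong eq) P)
  sub-cong eq (P ⋆ Q)    = cong₂ _⋆_ (sub-cong eq P) (sub-cong eq Q)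

  sub-ren : ∀ {n n' n''} (σ : Fin n' → Tm n'') (ρ : Fin n → Fin n') P →
            sub σ (ren ρ P) ≡ sub (λ i → σ (ρ i)) P
  sub-ren σ ρ (var x)    = refl
  sub-ren σ ρ (pair P Q) = cong₂ pair (sub-ren σ ρ P) (sub-ren σ ρ Q)
  sub-ren σ ρ (σ₁ P)     = cong σ₁ (sub-ren σ ρ P)
  sub-ren σ ρ (σ₂ P)     = cong σ₂ (sub-ren σ ρ P)
  sub-ren σ ρ (lam P)    =
    cong lam (trans (sub-ren (lift σ) (ext ρ) P) (sub-cong (λ { zero → refl ; (suc i) → refl }) P))
  sub-ren σ ρ (P ⋆ Q)    = cong₂ _⋆_ (sub-ren σ ρ P) (sub-ren σ ρ Q)

  ren-sub : ∀ {n n' n''} (ρ : Fin n' → Fin n'') (σ : Fin n → Tm n') P →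
            ren ρ (sub σ P) ≡ sub (λ i → ren ρ (σ i)) P
  ren-sub ρ σ (var x)    = refl
  ren-sub ρ σ (pair P Q) = cong₂ pair (ren-sub ρ σ P) (ren-sub ρ σ Q)
  ren-sub ρ σ (σ₁ P)     = cong σ₁ (ren-sub ρ σ P)
  ren-sub ρ σ (σ₂ P)     = cong σ₂ (ren-sub ρ σ P)
  ren-sub ρ σ (lam P)    = cong lam (trans (ren-sub (ext ρ) (lift σ) P) (sub-cong ext-lift P))
    where
    ext-lift : ∀ i → ren (ext ρ) (lift σ i) ≡ lift (λ j → ren ρ (σ j)) i
    ext-lift zero    = refl
    ext-lift (suc i) = ren-ext-wk ρ (σ i)
  ren-sub ρ σ (P ⋆ Q)    = cong₂ _⋆_ (ren-sub ρ σ P) (ren-sub ρ σ Q)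

  sub-var : ∀ {n n'} {σ : Fin n → Tm n'} {ρ : Fin n → Fin n'} → (∀ i → σ i ≡ var (ρ i)) →
            ∀ P → sub σ P ≡ ren ρ P
  sub-var eq (var x)    = eq x
  sub-var eq (pair P Q) = cong₂ pair (sub-var eq P) (sub-var eq Q)
  sub-var eq (σ₁ P)     = cong σ₁ (sub-var eq P)
  sub-var eq (σ₂ P)     = cong σ₂ (sub-var eq P)
  sub-var eq (lam P)    = cong lam (sub-var (λ { zero → refl ; (suc i) → cong wk (eq i) }) P)
  sub-var eq (P ⋆ Q)    = cong₂ _⋆_ (sub-var eq P) (sub-var eq Q)

  sub-id : ∀ {n} {σ : Fin n → Tm n} → (∀ i → σ i ≡ var i) → ∀ P → sub σ P ≡ P
  sub-id eq P = trans (sub-var eq P) (ren-id (λ _ → refl) P)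

  sub-wk : ∀ {n} (σ : Fin (suc n) → Tm n) → (∀ i → σ (suc i) ≡ var i) → ∀ P → sub σ (wk P) ≡ P
  sub-wk σ eq P = trans (sub-ren σ suc P) (sub-id eq P)

  sub-lift-wk : ∀ {n n'} (σ : Fin n → Tm n') P → sub (lift σ) (wk P) ≡ wk (sub σ P)
  sub-lift-wk σ P = trans (sub-ren (lift σ) suc P) (sym (ren-sub suc σ P))

  sub₀ : ∀ {n} → Tm n → Fin (suc n) → Tm n
  sub₀ Q zero    = Q
  sub₀ Q (suc i) = var i

  [≔]-sub₀ : ∀ {n} (P : Tm (suc n)) Q → P [≔ Q ] ≡ sub (sub₀ Q) P
  [≔]-sub₀ P Q = sub-cong (λ { zero → refl ; (suc i) → refl }) P

  wk-[≔] : ∀ {n} (M : Tm n) Q → wk M [≔ Q ] ≡ M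
  wk-[≔] M Q = trans ([≔]-sub₀ (wk M) Q) (sub-wk (sub₀ Q) (λ _ → refl) M)

  ren-[≔] : ∀ {n n'} (ρ : Fin n → Fin n') P Q → ren ρ (P [≔ Q ]) ≡ ren (ext ρ) P [≔ ren ρ Q ]
  ren-[≔] ρ P Q = begin
    ren ρ (P [≔ Q ])                  ≡⟨ cong (ren ρ) ([≔]-sub₀ P Q) ⟩
    ren ρ (sub (sub₀ Q) P)            ≡⟨ ren-sub ρ (sub₀ Q) P ⟩
    sub (λ i → ren ρ (sub₀ Q i)) P    ≡⟨ sub-cong (λ { zero → refl ; (suc i) → refl }) P ⟩
    sub (λ i → sub₀ (ren ρ Q) (ext ρ i)) P ≡⟨ sym (sub-ren (sub₀ (ren ρ Q)) (ext ρ) P) ⟩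
    sub (sub₀ (ren ρ Q)) (ren (ext ρ) P) ≡⟨ sym ([≔]-sub₀ (ren (ext ρ) P) (ren ρ Q)) ⟩
    ren (ext ρ) P [≔ ren ρ Q ]        ∎
    where open ≡-Reasoning

module SymTyping where
  open Sym
  open SymSubstitution using (sub₀; [≔]-sub₀)

  neg-involutive : ∀ A → neg (neg A) ≡ A
  neg-involutive (at k)   = refl
  neg-involutive (coat k) = refl
  neg-involutive (A ∧ B)  = cong₂ _∧_ (neg-involutive A) (neg-involutive B)
  neg-involutive (A ∨ B)  = cong₂ _∨_ (neg-involutive A) (neg-involutive B)

  -- inversion for λ-abstractions (the type of lam P is only known up to neg)
  lam⁻¹ : ∀ {n} {Γ : Vec MTy n} {P A} → Γ ⊢ lam P ∶ m A → (neg A ∷ Γ) ⊢ P ∶ bot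
  lam⁻¹ {Γ = Γ} {P} (lam {A = A} d) = subst (λ B → (B ∷ Γ) ⊢ P ∶ bot) (sym (neg-involutive A)) d

  lam⁻¹-neg : ∀ {n} {Γ : Vec MTy n} {P A} → Γ ⊢ lam P ∶ m (neg A) → (A ∷ Γ) ⊢ P ∶ bot
  lam⁻¹-neg {Γ = Γ} {P} {A} d = subst (λ B → (B ∷ Γ) ⊢ P ∶ bot) (neg-involutive A) (lam⁻¹ d)

  data IsStar {n} : Tm n → Set where
    star : ∀ P Q → IsStar (P ⋆ Q)

  bot⇒star : ∀ {n} {Γ : Vec MTy n} {P} → Γ ⊢ P ∶ bot → IsStar P
  bot⇒star (star _ _) = star _ _

  star⇒bot : ∀ {n} {Γ : Vec MTy n} {P T} → IsStar P → Γ ⊢ P ∶ T → T ≡ bot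
  star⇒bot (star _ _) (star _ _) = refl

  TyRen : ∀ {n n'} → Vec MTy n → Vec MTy n' → (Fin n → Fin n') → Set
  TyRen Γ Γ' ρ = ∀ i → lookup Γ' (ρ i) ≡ lookup Γ i

  ext-TyRen : ∀ {n n'} {Γ : Vec MTy n} {Γ' : Vec MTy n'} {ρ} A → TyRen Γ Γ' ρ → TyRen (A ∷ Γ) (A ∷ Γ') (ext ρ)
  ext-TyRen A r zero    = refl
  ext-TyRen A r (suc i) = r i

  ren-typing : ∀ {n n'} {Γ : Vec MTy n} {Γ' : Vec MTy n'} {ρ} → TyRen Γ Γ' ρ →
               ∀ {P T} → Γ ⊢ P ∶ T → Γ' ⊢ ren ρ P ∶ T
  ren-typing {Γ' = Γ'} {ρ} r (ax x) = subst (λ A → Γ' ⊢ var (ρ x) ∶ m A) (r x) (ax (ρ x))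
  ren-typing r (pair d e)       = pair (ren-typing r d) (ren-typing r e)
  ren-typing r (inj₁ d)         = inj₁ (ren-typing r d)
  ren-typing r (inj₂ d)         = inj₂ (ren-typing r d)
  ren-typing r (lam {A = A} d)  = lam (ren-typing (ext-TyRen A r) d)
  ren-typing r (star d e)       = star (ren-typing r d) (ren-typing r e)

  unren-typing : ∀ {n n'} {Γ : Vec MTy n} {Γ' : Vec MTy n'} {ρ} → TyRen Γ Γ' ρ →
                 ∀ P {T} → Γ' ⊢ ren ρ P ∶ T → Γ ⊢ P ∶ T
  unren-typing {Γ = Γ} r (var x) (ax _) = subst (λ A → Γ ⊢ var x ∶ m A) (sym (r x)) (ax x)
  unren-typing r (pair P Q) (pair d e)    = pair (unren-typing r P d) (unren-typing r Q e)
  unren-typing r (σ₁ P) (inj₁ d)          = inj₁ (unren-typing r P d)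
  unren-typing r (σ₂ P) (inj₂ d)          = inj₂ (unren-typing r P d)
  unren-typing r (lam P) (lam {A = A} d)  = lam (unren-typing (ext-TyRen A r) P d)
  unren-typing r (P ⋆ Q) (star d e)       = star (unren-typing r P d) (unren-typing r Q e)

  wk-typing : ∀ {n} {Γ : Vec MTy n} {P T} A → Γ ⊢ P ∶ T → (A ∷ Γ) ⊢ wk P ∶ T
  wk-typing A = ren-typing (λ _ → refl)

  TySub : ∀ {n n'} → Vec MTy n → Vec MTy n' → (Fin n → Tm n') → Set
  TySub Γ Δ σ = ∀ i → Δ ⊢ σ i ∶ m (lookup Γ i)

  lift-TySub : ∀ {n n'} {Γ : Vec MTy n} {Δ : Vec MTy n'} {σ} A → TySub Γ Δ σ → TySub (A ∷ Γ) (A ∷ Δ) (lift σ)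
  lift-TySub A s zero    = ax zero
  lift-TySub A s (suc i) = wk-typing A (s i)

  sub₀-TySub : ∀ {n} {Γ : Vec MTy n} {Q A} → Γ ⊢ Q ∶ m A → TySub (A ∷ Γ) Γ (sub₀ Q)
  sub₀-TySub dQ zero    = dQ
  sub₀-TySub dQ (suc i) = ax i

  sub-typing : ∀ {n n'} {Γ : Vec MTy n} {Δ : Vec MTy n'} {σ} → TySub Γ Δ σ →
               ∀ {P T} → Γ ⊢ P ∶ T → Δ ⊢ sub σ P ∶ T
  sub-typing s (ax x)          = s x
  sub-typing s (pair d e)      = pair (sub-typing s d) (sub-typing s e)
  sub-typing s (inj₁ d)        = inj₁ (sub-typing s d)
  sub-typing s (inj₂ d)        = inj₂ (sub-typing s d)
  sub-typing s (lam {A = A} d) = lam (sub-typing (lift-TySub A s) d)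
  sub-typing s (star d e)      = star (sub-typing s d) (sub-typing s e)

  [≔]-typing : ∀ {n} {Γ : Vec MTy n} {P Q A T} → (A ∷ Γ) ⊢ P ∶ T → Γ ⊢ Q ∶ m A → Γ ⊢ P [≔ Q ] ∶ T
  [≔]-typing {Γ = Γ} {P} {Q} {T = T} dP dQ =
    subst (Γ ⊢_∶ T) (sym ([≔]-sub₀ P Q)) (sub-typing (sub₀-TySub dQ) dP)

  hole-typing : ∀ {n k} (E : Ctx n k) {Γ : Vec MTy n} {M T} → Γ ⊢ plug E M ∶ T →
                ∃₂ λ (Γ' : Vec MTy k) T' → (Γ' ⊢ M ∶ T') × TyRen Γ Γ' (ctxRen E)
  hole-typing hole d                   = _ , _ , d , λ _ → refl
  hole-typing (pairˡ E Q) (pair d _)   = hole-typing E d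
  hole-typing (pairʳ Q E) (pair _ d)   = hole-typing E d
  hole-typing (σ₁c E) (inj₁ d)         = hole-typing E d
  hole-typing (σ₂c E) (inj₂ d)         = hole-typing E d
  hole-typing (lamc E) (lam d)         =
    let (Γ' , T' , dM , r) = hole-typing E d in Γ' , T' , dM , λ i → r (suc i)
  hole-typing (starˡ E Q) (star d _)   = hole-typing E d
  hole-typing (starʳ Q E) (star _ d)   = hole-typing E d

  ⊥-redex-typing : ∀ {n k} (E : Ctx n k) {P} {Γ₀ Γ : Vec MTy n} {T} →
                   Γ₀ ⊢ plug E (ren (ctxRen E) P) ∶ bot → Γ₀ ⊢ P ∶ bot →
                   Γ ⊢ plug E (ren (ctxRen E) P) ∶ T → (T ≡ bot) × (Γ ⊢ P ∶ bot)
  ⊥-redex-typing E {P} {Γ = Γ} d₀ dP₀ d =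
    let (_ , _ , dM , r) = hole-typing E d
        dP = unren-typing r P dM
    in star⇒bot (bot⇒star d₀) d , subst (Γ ⊢ P ∶_) (star⇒bot (bot⇒star dP₀) dP) dP

module SymReduction where
  open Sym
  open SymSubstitution
  open SymTyping

  Root : Set₁
  Root = ∀ {n} → Tm n → Tm n → Set

  infix 4 _▷R_ _▷S_ _→R_ _→S_ _⟶*_ _→S*_

  data _▷R_ {n} : Tm n → Tm n → Set where
    βˡ  : ∀ P Q → (lam P ⋆ Q) ▷R (P [≔ Q ])
    βʳ  : ∀ P Q → (Q ⋆ lam P) ▷R (P [≔ Q ])
    π₁ˡ : ∀ P₁ P₂ Q → (pair P₁ P₂ ⋆ σ₁ Q) ▷R (P₁ ⋆ Q)
    π₂ˡ : ∀ P₁ P₂ Q → (pair P₁ P₂ ⋆ σ₂ Q) ▷R (P₂ ⋆ Q)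
    π₁ʳ : ∀ P₁ P₂ Q → (σ₁ Q ⋆ pair P₁ P₂) ▷R (Q ⋆ P₁)
    π₂ʳ : ∀ P₁ P₂ Q → (σ₂ Q ⋆ pair P₁ P₂) ▷R (Q ⋆ P₂)

  data _▷S_ {n} : Tm n → Tm n → Set where
    ηˡ    : ∀ P → lam (wk P ⋆ var zero) ▷S P
    ηʳ    : ∀ P → lam (var zero ⋆ wk P) ▷S P
    ⊥-red : ∀ {k} (E : Ctx n k) P (Γ : Vec MTy n) → ¬ IsHole E →
            Γ ⊢ plug E (ren (ctxRen E) P) ∶ bot → Γ ⊢ P ∶ bot →
            plug E (ren (ctxRen E) P) ▷S P

  data Compat (_▷_ : Root) : Root where
    root    : ∀ {n} {P Q : Tm n} → P ▷ Q → Compat _▷_ P Q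
    inPairˡ : ∀ {n} {P P' : Tm n} Q → Compat _▷_ P P' → Compat _▷_ (pair P Q) (pair P' Q)
    inPairʳ : ∀ {n} P {Q Q' : Tm n} → Compat _▷_ Q Q' → Compat _▷_ (pair P Q) (pair P Q')
    inσ₁    : ∀ {n} {P P' : Tm n} → Compat _▷_ P P' → Compat _▷_ (σ₁ P) (σ₁ P')
    inσ₂    : ∀ {n} {P P' : Tm n} → Compat _▷_ P P' → Compat _▷_ (σ₂ P) (σ₂ P')
    inLam   : ∀ {n} {P P' : Tm (suc n)} → Compat _▷_ P P' → Compat _▷_ (lam P) (lam P')
    inStarˡ : ∀ {n} {P P' : Tm n} Q → Compat _▷_ P P' → Compat _▷_ (P ⋆ Q) (P' ⋆ Q)
    inStarʳ : ∀ {n} P {Q Q' : Tm n} → Compat _▷_ Q Q' → Compat _▷_ (P ⋆ Q) (P ⋆ Q')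

  _→R_ _→S_ : Root
  _→R_ = Compat _▷R_
  _→S_ = Compat _▷S_

  _⟶*_ _→S*_ : Root
  _⟶*_  = Star _⟶_
  _→S*_ = Star _→S_

  module _ {_▷_ : Root} where

    compat⇒⟶ : (∀ {n} {P Q : Tm n} → P ▷ Q → P ⟶ Q) → ∀ {n} {P Q : Tm n} → Compat _▷_ P Q → P ⟶ Q
    compat⇒⟶ f (root r)      = f r
    compat⇒⟶ f (inPairˡ Q s) = pairˡ Q (compat⇒⟶ f s)
    compat⇒⟶ f (inPairʳ P s) = pairʳ P (compat⇒⟶ f s)
    compat⇒⟶ f (inσ₁ s)      = σ₁c (compat⇒⟶ f s)
    compat⇒⟶ f (inσ₂ s)      = σ₂c (compat⇒⟶ f s)
    compat⇒⟶ f (inLam s)     = lamc (compat⇒⟶ f s)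
    compat⇒⟶ f (inStarˡ Q s) = starˡ Q (compat⇒⟶ f s)
    compat⇒⟶ f (inStarʳ P s) = starʳ P (compat⇒⟶ f s)

    compat-typing : (∀ {n} {Γ : Vec MTy n} {P Q T} → Γ ⊢ P ∶ T → P ▷ Q → Γ ⊢ Q ∶ T) →
                    ∀ {n} {Γ : Vec MTy n} {P Q T} → Γ ⊢ P ∶ T → Compat _▷_ P Q → Γ ⊢ Q ∶ T
    compat-typing f d          (root r)      = f d r
    compat-typing f (pair d e) (inPairˡ _ s) = pair (compat-typing f d s) e
    compat-typing f (pair d e) (inPairʳ _ s) = pair d (compat-typing f e s)
    compat-typing f (inj₁ d)   (inσ₁ s)      = inj₁ (compat-typing f d s)
    compat-typing f (inj₂ d)   (inσ₂ s)      = inj₂ (compat-typing f d s)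
    compat-typing f (lam d)    (inLam s)     = lam (compat-typing f d s)
    compat-typing f (star d e) (inStarˡ _ s) = star (compat-typing f d s) e
    compat-typing f (star d e) (inStarʳ _ s) = star d (compat-typing f e s)

    compat-ren : (∀ {n n'} (ρ : Fin n → Fin n') {P Q} → P ▷ Q → ren ρ P ▷ ren ρ Q) →
                 ∀ {n n'} (ρ : Fin n → Fin n') {P Q} → Compat _▷_ P Q → Compat _▷_ (ren ρ P) (ren ρ Q)
    compat-ren f ρ (root r)      = root (f ρ r)
    compat-ren f ρ (inPairˡ _ s) = inPairˡ _ (compat-ren f ρ s)
    compat-ren f ρ (inPairʳ _ s) = inPairʳ _ (compat-ren f ρ s)
    compat-ren f ρ (inσ₁ s)      = inσ₁ (compat-ren f ρ s)
    compat-ren f ρ (inσ₂ s)      = inσ₂ (compat-ren f ρ s)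
    compat-ren f ρ (inLam s)     = inLam (compat-ren f (ext ρ) s)
    compat-ren f ρ (inStarˡ _ s) = inStarˡ _ (compat-ren f ρ s)
    compat-ren f ρ (inStarʳ _ s) = inStarʳ _ (compat-ren f ρ s)

    compat-plug : ∀ {n k} (E : Ctx n k) {M M'} → Compat _▷_ M M' → Compat _▷_ (plug E M) (plug E M')
    compat-plug hole        s = s
    compat-plug (pairˡ E Q) s = inPairˡ Q (compat-plug E s)
    compat-plug (pairʳ Q E) s = inPairʳ Q (compat-plug E s)
    compat-plug (σ₁c E)     s = inσ₁ (compat-plug E s)
    compat-plug (σ₂c E)     s = inσ₂ (compat-plug E s)
    compat-plug (lamc E)    s = inLam (compat-plug E s)
    compat-plug (starˡ E Q) s = inStarˡ Q (compat-plug E s)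
    compat-plug (starʳ Q E) s = inStarʳ Q (compat-plug E s)

  →R⇒⟶ : ∀ {n} {P Q : Tm n} → P →R Q → P ⟶ Q
  →R⇒⟶ = compat⇒⟶ λ { (βˡ P Q) → βˡ P Q ; (βʳ P Q) → βʳ P Q
                     ; (π₁ˡ P₁ P₂ Q) → π₁ˡ P₁ P₂ Q ; (π₂ˡ P₁ P₂ Q) → π₂ˡ P₁ P₂ Q
                     ; (π₁ʳ P₁ P₂ Q) → π₁ʳ P₁ P₂ Q ; (π₂ʳ P₁ P₂ Q) → π₂ʳ P₁ P₂ Q }

  →S⇒⟶ : ∀ {n} {P Q : Tm n} → P →S Q → P ⟶ Q
  →S⇒⟶ = compat⇒⟶ λ { (ηˡ P) → ηˡ P ; (ηʳ P) → ηʳ P ; (⊥-red E P Γ nh d dP) → ⊥-red E P Γ nh d dP }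

  →S*⇒⟶* : ∀ {n} {P Q : Tm n} → P →S* Q → P ⟶* Q
  →S*⇒⟶* = gmap (λ P → P) →S⇒⟶

  split : ∀ {n} {P Q : Tm n} → P ⟶ Q → (P →R Q) ⊎ (P →S Q)
  split (βˡ P Q)                = inj₁ (root (βˡ P Q))
  split (βʳ P Q)                = inj₁ (root (βʳ P Q))
  split (π₁ˡ P₁ P₂ Q)           = inj₁ (root (π₁ˡ P₁ P₂ Q))
  split (π₂ˡ P₁ P₂ Q)           = inj₁ (root (π₂ˡ P₁ P₂ Q))
  split (π₁ʳ P₁ P₂ Q)           = inj₁ (root (π₁ʳ P₁ P₂ Q))
  split (π₂ʳ P₁ P₂ Q)           = inj₁ (root (π₂ʳ P₁ P₂ Q))
  split (ηˡ P)                  = inj₂ (root (ηˡ P))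
  split (ηʳ P)                  = inj₂ (root (ηʳ P))
  split (⊥-red E P Γ nh d dP)   = inj₂ (root (⊥-red E P Γ nh d dP))
  split (pairˡ Q s)             = Sum.map (inPairˡ Q) (inPairˡ Q) (split s)
  split (pairʳ P s)             = Sum.map (inPairʳ P) (inPairʳ P) (split s)
  split (σ₁c s)                 = Sum.map inσ₁ inσ₁ (split s)
  split (σ₂c s)                 = Sum.map inσ₂ inσ₂ (split s)
  split (lamc s)                = Sum.map inLam inLam (split s)
  split (starˡ Q s)             = Sum.map (inStarˡ Q) (inStarˡ Q) (split s)
  split (starʳ P s)             = Sum.map (inStarʳ P) (inStarʳ P) (split s)

  ▷R-typing : ∀ {n} {Γ : Vec MTy n} {P Q T} → Γ ⊢ P ∶ T → P ▷R Q → Γ ⊢ Q ∶ T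
  ▷R-typing (star d e) (βˡ P Q) = [≔]-typing (lam⁻¹-neg d) e
  ▷R-typing (star d e) (βʳ P Q) = [≔]-typing (lam⁻¹ e) d
  ▷R-typing (star (pair d₁ d₂) (inj₁ e)) (π₁ˡ _ _ _) = star d₁ e
  ▷R-typing (star (pair d₁ d₂) (inj₂ e)) (π₂ˡ _ _ _) = star d₂ e
  ▷R-typing (star (inj₁ e) (pair d₁ d₂)) (π₁ʳ _ _ _) = star e d₁
  ▷R-typing (star (inj₂ e) (pair d₁ d₂)) (π₂ʳ _ _ _) = star e d₂

  ▷S-typing : ∀ {n} {Γ : Vec MTy n} {P Q T} → Γ ⊢ P ∶ T → P ▷S Q → Γ ⊢ Q ∶ T
  ▷S-typing d (⊥-red E P Γ₀ nh d₀ dP₀) with ⊥-redex-typing E d₀ dP₀ d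
  ... | refl , dP = dP
  ▷S-typing (lam (star dP (ax zero))) (ηˡ P) = unren-typing (λ _ → refl) P dP
  ▷S-typing {Γ = Γ} (lam (star {A = A} (ax zero) dP)) (ηʳ P) =
    subst (λ B → Γ ⊢ P ∶ m B) (sym (neg-involutive A)) (unren-typing (λ _ → refl) P dP)

  →R-typing : ∀ {n} {Γ : Vec MTy n} {P Q T} → Γ ⊢ P ∶ T → P →R Q → Γ ⊢ Q ∶ T
  →R-typing = compat-typing ▷R-typing

  →S-typing : ∀ {n} {Γ : Vec MTy n} {P Q T} → Γ ⊢ P ∶ T → P →S Q → Γ ⊢ Q ∶ T
  →S-typing = compat-typing ▷S-typing

  size : ∀ {n} → Tm n → ℕ
  size (var x)    = 1
  size (pair P Q) = suc (size P + size Q)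
  size (σ₁ P)     = suc (size P)
  size (σ₂ P)     = suc (size P)
  size (lam P)    = suc (size P)
  size (P ⋆ Q)    = suc (size P + size Q)

  size-ren : ∀ {n n'} (ρ : Fin n → Fin n') P → size (ren ρ P) ≡ size P
  size-ren ρ (var x)    = refl
  size-ren ρ (pair P Q) = cong₂ (λ a b → suc (a + b)) (size-ren ρ P) (size-ren ρ Q)
  size-ren ρ (σ₁ P)     = cong suc (size-ren ρ P)
  size-ren ρ (σ₂ P)     = cong suc (size-ren ρ P)
  size-ren ρ (lam P)    = cong suc (size-ren (ext ρ) P)
  size-ren ρ (P ⋆ Q)    = cong₂ (λ a b → suc (a + b)) (size-ren ρ P) (size-ren ρ Q)

  size-plug< : ∀ {n k} (E : Ctx n k) M → ¬ IsHole E → size M < size (plug E M)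
  size-plug  : ∀ {n k} (E : Ctx n k) M → size M ≤ size (plug E M)
  size-plug< hole        M nh = ⊥-elim (nh hole)
  size-plug< (pairˡ E Q) M _  = s≤s (≤-trans (size-plug E M) (m≤m+n _ _))
  size-plug< (pairʳ Q E) M _  = s≤s (≤-trans (size-plug E M) (m≤n+m _ _))
  size-plug< (σ₁c E)     M _  = s≤s (size-plug E M)
  size-plug< (σ₂c E)     M _  = s≤s (size-plug E M)
  size-plug< (lamc E)    M _  = s≤s (size-plug E M)
  size-plug< (starˡ E Q) M _  = s≤s (≤-trans (size-plug E M) (m≤m+n _ _))
  size-plug< (starʳ Q E) M _  = s≤s (≤-trans (size-plug E M) (m≤n+m _ _))
  size-plug hole M = ≤-refl
  size-plug E@(pairˡ _ _) M = <⇒≤ (size-plug< E M λ ())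
  size-plug E@(pairʳ _ _) M = <⇒≤ (size-plug< E M λ ())
  size-plug E@(σ₁c _)     M = <⇒≤ (size-plug< E M λ ())
  size-plug E@(σ₂c _)     M = <⇒≤ (size-plug< E M λ ())
  size-plug E@(lamc _)    M = <⇒≤ (size-plug< E M λ ())
  size-plug E@(starˡ _ _) M = <⇒≤ (size-plug< E M λ ())
  size-plug E@(starʳ _ _) M = <⇒≤ (size-plug< E M λ ())

  -- η and ⊥ erase everything but a renamed subterm
  ▷S-size : ∀ {n} {P Q : Tm n} → P ▷S Q → size Q < size P
  ▷S-size (ηˡ P) = s≤s (≤-trans (≤-reflexive (sym (size-ren suc P))) (≤-trans (m≤m+n _ 1) (n≤1+n _)))
  ▷S-size (ηʳ P) = s≤s (≤-trans (≤-reflexive (sym (size-ren suc P))) (≤-trans (m≤n+m _ 1) (n≤1+n _)))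
  ▷S-size (⊥-red E P Γ nh d dP) =
    subst (_< size (plug E (ren (ctxRen E) P))) (size-ren (ctxRen E) P) (size-plug< E _ nh)

  →S-size : ∀ {n} {P Q : Tm n} → P →S Q → size Q < size P
  →S-size (root s)      = ▷S-size s
  →S-size (inPairˡ Q s) = s≤s (+-monoˡ-< (size Q) (→S-size s))
  →S-size (inPairʳ P s) = s≤s (+-monoʳ-< (size P) (→S-size s))
  →S-size (inσ₁ s)      = s≤s (→S-size s)
  →S-size (inσ₂ s)      = s≤s (→S-size s)
  →S-size (inLam s)     = s≤s (→S-size s)
  →S-size (inStarˡ Q s) = s≤s (+-monoˡ-< (size Q) (→S-size s))
  →S-size (inStarʳ P s) = s≤s (+-monoʳ-< (size P) (→S-size s))

  ▷R-ren : ∀ {n n'} (ρ : Fin n → Fin n') {P Q} → P ▷R Q → ren ρ P ▷R ren ρ Q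
  ▷R-ren ρ (βˡ P Q) = subst ((lam (ren (ext ρ) P) ⋆ ren ρ Q) ▷R_) (sym (ren-[≔] ρ P Q)) (βˡ _ _)
  ▷R-ren ρ (βʳ P Q) = subst ((ren ρ Q ⋆ lam (ren (ext ρ) P)) ▷R_) (sym (ren-[≔] ρ P Q)) (βʳ _ _)
  ▷R-ren ρ (π₁ˡ _ _ _) = π₁ˡ _ _ _
  ▷R-ren ρ (π₂ˡ _ _ _) = π₂ˡ _ _ _
  ▷R-ren ρ (π₁ʳ _ _ _) = π₁ʳ _ _ _
  ▷R-ren ρ (π₂ʳ _ _ _) = π₂ʳ _ _ _

  →R-ren : ∀ {n n'} (ρ : Fin n → Fin n') {P Q} → P →R Q → ren ρ P →R ren ρ Q
  →R-ren = compat-ren ▷R-ren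

  record SubstitutedCtx {n n' k} (σ : Fin n → Tm n') (E : Ctx n k) : Set where
    field
      {k'}      : ℕ
      E'        : Ctx n' k'
      σ-hole    : Fin k → Tm k'
      plug-sub  : ∀ M → sub σ (plug E M) ≡ plug E' (sub σ-hole M)
      hole-ren  : ∀ i → σ-hole (ctxRen E i) ≡ ren (ctxRen E') (σ i)
      non-hole  : ¬ IsHole E → ¬ IsHole E'

  substCtx : ∀ {n n' k} (σ : Fin n → Tm n') (E : Ctx n k) → SubstitutedCtx σ E
  substCtx σ hole = record
    { E' = hole ; σ-hole = σ ; plug-sub = λ _ → refl
    ; hole-ren = λ i → sym (ren-id (λ _ → refl) (σ i)) ; non-hole = λ nh _ → nh hole }
  substCtx σ (pairˡ E Q) = let open SubstitutedCtx (substCtx σ E) in record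
    { E' = pairˡ E' (sub σ Q) ; σ-hole = σ-hole ; plug-sub = λ M → cong₂ pair (plug-sub M) refl
    ; hole-ren = hole-ren ; non-hole = λ _ () }
  substCtx σ (pairʳ Q E) = let open SubstitutedCtx (substCtx σ E) in record
    { E' = pairʳ (sub σ Q) E' ; σ-hole = σ-hole ; plug-sub = λ M → cong₂ pair refl (plug-sub M)
    ; hole-ren = hole-ren ; non-hole = λ _ () }
  substCtx σ (σ₁c E) = let open SubstitutedCtx (substCtx σ E) in record
    { E' = σ₁c E' ; σ-hole = σ-hole ; plug-sub = λ M → cong σ₁ (plug-sub M)
    ; hole-ren = hole-ren ; non-hole = λ _ () }
  substCtx σ (σ₂c E) = let open SubstitutedCtx (substCtx σ E) in record
    { E' = σ₂c E' ; σ-hole = σ-hole ; plug-sub = λ M → cong σ₂ (plug-sub M)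
    ; hole-ren = hole-ren ; non-hole = λ _ () }
  substCtx σ (lamc E) = let open SubstitutedCtx (substCtx (lift σ) E) in record
    { E' = lamc E' ; σ-hole = σ-hole ; plug-sub = λ M → cong lam (plug-sub M)
    ; hole-ren = λ i → trans (hole-ren (suc i)) (ren-ren (ctxRen E') suc (σ i)) ; non-hole = λ _ () }
  substCtx σ (starˡ E Q) = let open SubstitutedCtx (substCtx σ E) in record
    { E' = starˡ E' (sub σ Q) ; σ-hole = σ-hole ; plug-sub = λ M → cong₂ _⋆_ (plug-sub M) refl
    ; hole-ren = hole-ren ; non-hole = λ _ () }
  substCtx σ (starʳ Q E) = let open SubstitutedCtx (substCtx σ E) in record
    { E' = starʳ (sub σ Q) E' ; σ-hole = σ-hole ; plug-sub = λ M → cong₂ _⋆_ refl (plug-sub M)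
    ; hole-ren = hole-ren ; non-hole = λ _ () }

  ⊥-redex-sub : ∀ {n n' k} (σ : Fin n → Tm n') (E : Ctx n k) P →
                let open SubstitutedCtx (substCtx σ E) in
                sub σ (plug E (ren (ctxRen E) P)) ≡ plug E' (ren (ctxRen E') (sub σ P))
  ⊥-redex-sub σ E P = let open SubstitutedCtx (substCtx σ E) in begin
    sub σ (plug E (ren (ctxRen E) P))                   ≡⟨ plug-sub _ ⟩
    plug E' (sub σ-hole (ren (ctxRen E) P))             ≡⟨ cong (plug E') (sub-ren σ-hole (ctxRen E) P) ⟩
    plug E' (sub (λ i → σ-hole (ctxRen E i)) P)         ≡⟨ cong (plug E') (sub-cong hole-ren P) ⟩
    plug E' (sub (λ i → ren (ctxRen E') (σ i)) P)       ≡⟨ cong (plug E') (sym (ren-sub (ctxRen E') σ P)) ⟩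
    plug E' (ren (ctxRen E') (sub σ P))                 ∎
    where open ≡-Reasoning

  -- Structural steps of typed terms are stable under typed substitutions
  -- (typing is needed to re-establish the side conditions of the ⊥-rule).
  ▷S-sub : ∀ {n n'} {Γ : Vec MTy n} {Δ : Vec MTy n'} {σ} → TySub Γ Δ σ →
           ∀ {P Q T} → Γ ⊢ P ∶ T → P ▷S Q → sub σ P ▷S sub σ Q
  ▷S-sub {σ = σ} s d (ηˡ P) = subst (λ X → lam (X ⋆ var zero) ▷S sub σ P) (sym (sub-lift-wk σ P)) (ηˡ _)
  ▷S-sub {σ = σ} s d (ηʳ P) = subst (λ X → lam (var zero ⋆ X) ▷S sub σ P) (sym (sub-lift-wk σ P)) (ηʳ _)
  ▷S-sub {Δ = Δ} {σ} s d (⊥-red E P Γ₀ nh d₀ dP₀) with ⊥-redex-typing E d₀ dP₀ d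
  ... | refl , dP = subst (_▷S sub σ P) (sym redex)
        (⊥-red E' (sub σ P) Δ (non-hole nh) (subst (Δ ⊢_∶ bot) redex (sub-typing s d)) (sub-typing s dP))
    where
    open SubstitutedCtx (substCtx σ E)
    redex = ⊥-redex-sub σ E P

  →S-sub : ∀ {n n'} {Γ : Vec MTy n} {Δ : Vec MTy n'} {σ} → TySub Γ Δ σ →
           ∀ {P Q T} → Γ ⊢ P ∶ T → P →S Q → sub σ P →S sub σ Q
  →S-sub s d               (root r)      = root (▷S-sub s d r)
  →S-sub s (pair d e)      (inPairˡ _ r) = inPairˡ _ (→S-sub s d r)
  →S-sub s (pair d e)      (inPairʳ _ r) = inPairʳ _ (→S-sub s e r)
  →S-sub s (inj₁ d)        (inσ₁ r)      = inσ₁ (→S-sub s d r)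
  →S-sub s (inj₂ d)        (inσ₂ r)      = inσ₂ (→S-sub s d r)
  →S-sub s (lam {A = A} d) (inLam r)     = inLam (→S-sub (lift-TySub A s) d r)
  →S-sub s (star d e)      (inStarˡ _ r) = inStarˡ _ (→S-sub s d r)
  →S-sub s (star d e)      (inStarʳ _ r) = inStarʳ _ (→S-sub s e r)

  →S-wk : ∀ {n} {Γ : Vec MTy n} {P Q T} A → Γ ⊢ P ∶ T → P →S Q → wk P →S wk Q
  →S-wk {Γ = Γ} {P} {Q} A d r =
    subst₂ _→S_ (shift P) (shift Q) (→S-sub {Δ = A ∷ Γ} (λ i → ax (suc i)) d r)
    where
    shift : ∀ R → sub (λ i → var (suc i)) R ≡ wk R
    shift = sub-var (λ _ → refl)

  →S*-wk : ∀ {n} {Γ : Vec MTy n} {P Q T} A → Γ ⊢ P ∶ T → P →S* Q → wk P →S* wk Q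
  →S*-wk A d ε        = ε
  →S*-wk A d (r ◅ r*) = →S-wk A d r ◅ →S*-wk A (→S-typing d r) r*

  →S*-sub : ∀ {n n'} {Γ : Vec MTy n} {Δ : Vec MTy n'} {σ σ'} → TySub Γ Δ σ → (∀ i → σ i →S* σ' i) →
            ∀ {P T} → Γ ⊢ P ∶ T → sub σ P →S* sub σ' P
  →S*-sub s r* (ax x) = r* x
  →S*-sub {σ = σ} {σ'} s r* (pair {P₁ = P} {Q} d e) =
    gmap (λ X → pair X (sub σ Q)) (inPairˡ _) (→S*-sub s r* d) ◅◅ gmap (pair (sub σ' P)) (inPairʳ _) (→S*-sub s r* e)
  →S*-sub s r* (inj₁ d) = gmap σ₁ inσ₁ (→S*-sub s r* d)
  →S*-sub s r* (inj₂ d) = gmap σ₂ inσ₂ (→S*-sub s r* d)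
  →S*-sub s r* (lam {A = A} d) = gmap lam inLam (→S*-sub (lift-TySub A s) lifted d)
    where
    lifted : ∀ i → lift _ i →S* lift _ i
    lifted zero    = ε
    lifted (suc i) = →S*-wk A (s i) (r* i)
  →S*-sub {σ = σ} {σ'} s r* (star {P₁ = P} {Q} d e) =
    gmap (λ X → X ⋆ sub σ Q) (inStarˡ _) (→S*-sub s r* d) ◅◅ gmap (sub σ' P ⋆_) (inStarʳ _) (→S*-sub s r* e)

  [≔]-→S : ∀ {n} {Γ : Vec MTy n} {A P P' Q T} → (A ∷ Γ) ⊢ P ∶ T → Γ ⊢ Q ∶ m A →
           P →S P' → P [≔ Q ] →S P' [≔ Q ]
  [≔]-→S {P = P} {P'} {Q} dP dQ r =
    subst₂ _→S_ (sym ([≔]-sub₀ P Q)) (sym ([≔]-sub₀ P' Q)) (→S-sub (sub₀-TySub dQ) dP r)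

  [≔]-→S* : ∀ {n} {Γ : Vec MTy n} {A P Q Q' T} → (A ∷ Γ) ⊢ P ∶ T → Γ ⊢ Q ∶ m A →
            Q →S Q' → P [≔ Q ] →S* P [≔ Q' ]
  [≔]-→S* {P = P} {Q} {Q'} dP dQ r =
    subst₂ _→S*_ (sym ([≔]-sub₀ P Q)) (sym ([≔]-sub₀ P Q')) (→S*-sub (sub₀-TySub dQ) arg dP)
    where
    arg : ∀ i → sub₀ Q i →S* sub₀ Q' i
    arg zero    = return r
    arg (suc i) = ε

module Swapping where
  open Sym
  open SymSubstitution
  open SymTyping

  infix 4 _≋_
  data _≋_ {n} : Tm n → Tm n → Set where
    ≋var  : ∀ x → var x ≋ var x
    ≋pair : ∀ {P P' Q Q'} → P ≋ P' → Q ≋ Q' → pair P Q ≋ pair P' Q'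
    ≋σ₁   : ∀ {P P'} → P ≋ P' → σ₁ P ≋ σ₁ P'
    ≋σ₂   : ∀ {P P'} → P ≋ P' → σ₂ P ≋ σ₂ P'
    ≋lam  : ∀ {P P'} → P ≋ P' → lam P ≋ lam P'
    ≋star : ∀ {P P' Q Q'} → P ≋ P' → Q ≋ Q' → (P ⋆ Q) ≋ (P' ⋆ Q')
    ≋swap : ∀ {P P' Q Q'} → P ≋ P' → Q ≋ Q' → (P ⋆ Q) ≋ (Q' ⋆ P')

  ≋-refl : ∀ {n} {P : Tm n} → P ≋ P
  ≋-refl {P = var x}    = ≋var x
  ≋-refl {P = pair P Q} = ≋pair ≋-refl ≋-refl
  ≋-refl {P = σ₁ P}     = ≋σ₁ ≋-refl
  ≋-refl {P = σ₂ P}     = ≋σ₂ ≋-refl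
  ≋-refl {P = lam P}    = ≋lam ≋-refl
  ≋-refl {P = P ⋆ Q}    = ≋star ≋-refl ≋-refl

  ≋-swap : ∀ {n} (P Q : Tm n) → (P ⋆ Q) ≋ (Q ⋆ P)
  ≋-swap P Q = ≋swap ≋-refl ≋-refl

  ≋-trans : ∀ {n} {P Q R : Tm n} → P ≋ Q → Q ≋ R → P ≋ R
  ≋-trans (≋var x)    (≋var .x)   = ≋var x
  ≋-trans (≋pair a b) (≋pair c d) = ≋pair (≋-trans a c) (≋-trans b d)
  ≋-trans (≋σ₁ a)     (≋σ₁ c)     = ≋σ₁ (≋-trans a c)
  ≋-trans (≋σ₂ a)     (≋σ₂ c)     = ≋σ₂ (≋-trans a c)
  ≋-trans (≋lam a)    (≋lam c)    = ≋lam (≋-trans a c)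
  ≋-trans (≋star a b) (≋star c d) = ≋star (≋-trans a c) (≋-trans b d)
  ≋-trans (≋star a b) (≋swap c d) = ≋swap (≋-trans a c) (≋-trans b d)
  ≋-trans (≋swap a b) (≋star c d) = ≋swap (≋-trans a d) (≋-trans b c)
  ≋-trans (≋swap a b) (≋swap c d) = ≋star (≋-trans a d) (≋-trans b c)

  ≋-ren : ∀ {n n'} (ρ : Fin n → Fin n') {P P'} → P ≋ P' → ren ρ P ≋ ren ρ P'
  ≋-ren ρ (≋var x)    = ≋var (ρ x)
  ≋-ren ρ (≋pair a b) = ≋pair (≋-ren ρ a) (≋-ren ρ b)
  ≋-ren ρ (≋σ₁ a)     = ≋σ₁ (≋-ren ρ a)
  ≋-ren ρ (≋σ₂ a)     = ≋σ₂ (≋-ren ρ a)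
  ≋-ren ρ (≋lam a)    = ≋lam (≋-ren (ext ρ) a)
  ≋-ren ρ (≋star a b) = ≋star (≋-ren ρ a) (≋-ren ρ b)
  ≋-ren ρ (≋swap a b) = ≋swap (≋-ren ρ a) (≋-ren ρ b)

  ≋-sub : ∀ {n n'} {σ σ' : Fin n → Tm n'} → (∀ i → σ i ≋ σ' i) → ∀ {P P'} → P ≋ P' → sub σ P ≋ sub σ' P'
  ≋-sub h (≋var x)    = h x
  ≋-sub h (≋pair a b) = ≋pair (≋-sub h a) (≋-sub h b)
  ≋-sub h (≋σ₁ a)     = ≋σ₁ (≋-sub h a)
  ≋-sub h (≋σ₂ a)     = ≋σ₂ (≋-sub h a)
  ≋-sub h (≋lam a)    = ≋lam (≋-sub (λ { zero → ≋var zero ; (suc i) → ≋-ren suc (h i) }) a)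
  ≋-sub h (≋star a b) = ≋star (≋-sub h a) (≋-sub h b)
  ≋-sub h (≋swap a b) = ≋swap (≋-sub h a) (≋-sub h b)

  ≋-[≔] : ∀ {n} {P P' : Tm (suc n)} {Q Q'} → P ≋ P' → Q ≋ Q' → P [≔ Q ] ≋ P' [≔ Q' ]
  ≋-[≔] {P = P} {P'} {Q} {Q'} a b =
    subst₂ _≋_ (sym ([≔]-sub₀ P Q)) (sym ([≔]-sub₀ P' Q')) (≋-sub (λ { zero → b ; (suc i) → ≋var i }) a)

  -- swapping the arguments of P ⋆ Q is allowed because neg is involutive
  ≋-typing : ∀ {n} {Γ : Vec MTy n} {P P' T} → Γ ⊢ P ∶ T → P ≋ P' → Γ ⊢ P' ∶ T
  ≋-typing (ax x)     (≋var .x)   = ax x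
  ≋-typing (pair d e) (≋pair a b) = pair (≋-typing d a) (≋-typing e b)
  ≋-typing (inj₁ d)   (≋σ₁ a)     = inj₁ (≋-typing d a)
  ≋-typing (inj₂ d)   (≋σ₂ a)     = inj₂ (≋-typing d a)
  ≋-typing (lam d)    (≋lam a)    = lam (≋-typing d a)
  ≋-typing (star d e) (≋star a b) = star (≋-typing d a) (≋-typing e b)
  ≋-typing {Γ = Γ} (star {A = A} d e) (≋swap {Q = Q} a b) =
    star (≋-typing (subst (λ B → Γ ⊢ Q ∶ m B) (sym (neg-involutive A)) e) b) (≋-typing d a)

  ≋-unren : ∀ {n n'} (ρ : Fin n → Fin n') P {X} → ren ρ P ≋ X → ∃ λ P' → (X ≡ ren ρ P') × (P ≋ P')
  ≋-unren ρ (var x) (≋var _) = var x , refl , ≋var x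
  ≋-unren ρ (pair P Q) (≋pair a b) with ≋-unren ρ P a | ≋-unren ρ Q b
  ... | P' , refl , a' | Q' , refl , b' = pair P' Q' , refl , ≋pair a' b'
  ≋-unren ρ (σ₁ P) (≋σ₁ a) with ≋-unren ρ P a
  ... | P' , refl , a' = σ₁ P' , refl , ≋σ₁ a'
  ≋-unren ρ (σ₂ P) (≋σ₂ a) with ≋-unren ρ P a
  ... | P' , refl , a' = σ₂ P' , refl , ≋σ₂ a'
  ≋-unren ρ (lam P) (≋lam a) with ≋-unren (ext ρ) P a
  ... | P' , refl , a' = lam P' , refl , ≋lam a'
  ≋-unren ρ (P ⋆ Q) (≋star a b) with ≋-unren ρ P a | ≋-unren ρ Q b
  ... | P' , refl , a' | Q' , refl , b' = P' ⋆ Q' , refl , ≋star a' b'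
  ≋-unren ρ (P ⋆ Q) (≋swap a b) with ≋-unren ρ P a | ≋-unren ρ Q b
  ... | P' , refl , a' | Q' , refl , b' = Q' ⋆ P' , refl , ≋swap a' b'

  record Unplugged {n k} (E : Ctx n k) (M : Tm k) (X : Tm n) : Set where
    field
      E'       : Ctx n k
      M'       : Tm k
      X-plug   : X ≡ plug E' M'
      M≋M'     : M ≋ M'
      same-ren : ∀ i → ctxRen E' i ≡ ctxRen E i
      non-hole : ¬ IsHole E → ¬ IsHole E'

  ≋-unplug : ∀ {n k} (E : Ctx n k) M {X} → plug E M ≋ X → Unplugged E M X
  ≋-unplug hole M {X} a = record
    { E' = hole ; M' = X ; X-plug = refl ; M≋M' = a ; same-ren = λ _ → refl ; non-hole = λ nh → nh }
  ≋-unplug (pairˡ E Q) M (≋pair {Q' = Q'} a b) = let open Unplugged (≋-unplug E M a) in record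
    { E' = pairˡ E' Q' ; M' = M' ; X-plug = cong₂ pair X-plug refl ; M≋M' = M≋M' ; same-ren = same-ren ; non-hole = λ _ () }
  ≋-unplug (pairʳ Q E) M (≋pair {P' = Q'} b a) = let open Unplugged (≋-unplug E M a) in record
    { E' = pairʳ Q' E' ; M' = M' ; X-plug = cong₂ pair refl X-plug ; M≋M' = M≋M' ; same-ren = same-ren ; non-hole = λ _ () }
  ≋-unplug (σ₁c E) M (≋σ₁ a) = let open Unplugged (≋-unplug E M a) in record
    { E' = σ₁c E' ; M' = M' ; X-plug = cong σ₁ X-plug ; M≋M' = M≋M' ; same-ren = same-ren ; non-hole = λ _ () }
  ≋-unplug (σ₂c E) M (≋σ₂ a) = let open Unplugged (≋-unplug E M a) in record
    { E' = σ₂c E' ; M' = M' ; X-plug = cong σ₂ X-plug ; M≋M' = M≋M' ; same-ren = same-ren ; non-hole = λ _ () }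
  ≋-unplug (lamc E) M (≋lam a) = let open Unplugged (≋-unplug E M a) in record
    { E' = lamc E' ; M' = M' ; X-plug = cong lam X-plug ; M≋M' = M≋M' ; same-ren = λ i → same-ren (suc i) ; non-hole = λ _ () }
  ≋-unplug (starˡ E Q) M (≋star {Q' = Q'} a b) = let open Unplugged (≋-unplug E M a) in record
    { E' = starˡ E' Q' ; M' = M' ; X-plug = cong₂ _⋆_ X-plug refl ; M≋M' = M≋M' ; same-ren = same-ren ; non-hole = λ _ () }
  ≋-unplug (starˡ E Q) M (≋swap {Q' = Q'} a b) = let open Unplugged (≋-unplug E M a) in record
    { E' = starʳ Q' E' ; M' = M' ; X-plug = cong₂ _⋆_ refl X-plug ; M≋M' = M≋M' ; same-ren = same-ren ; non-hole = λ _ () }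
  ≋-unplug (starʳ Q E) M (≋star {P' = Q'} b a) = let open Unplugged (≋-unplug E M a) in record
    { E' = starʳ Q' E' ; M' = M' ; X-plug = cong₂ _⋆_ refl X-plug ; M≋M' = M≋M' ; same-ren = same-ren ; non-hole = λ _ () }
  ≋-unplug (starʳ Q E) M (≋swap {P' = Q'} b a) = let open Unplugged (≋-unplug E M a) in record
    { E' = starˡ E' Q' ; M' = M' ; X-plug = cong₂ _⋆_ X-plug refl ; M≋M' = M≋M' ; same-ren = same-ren ; non-hole = λ _ () }

  ≋-⊥-redex : ∀ {n k} (E : Ctx n k) P (Γ : Vec MTy n) → ¬ IsHole E →
              Γ ⊢ plug E (ren (ctxRen E) P) ∶ bot → Γ ⊢ P ∶ bot →
              ∀ {X} → plug E (ren (ctxRen E) P) ≋ X → ∃ λ P' → (X ⟶ P') × (P ≋ P')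
  ≋-⊥-redex E P Γ nh d dP {X} a with ≋-unplug E _ a
  ... | u with ≋-unren (ctxRen E) P (Unplugged.M≋M' u)
  ... | P' , M'≡ , P≋P' =
    P' , subst (_⟶ P') (sym X-redex) contract , P≋P'
    where
    open Unplugged u
    X-redex : X ≡ plug E' (ren (ctxRen E') P')
    X-redex = trans X-plug (cong (plug E') (trans M'≡ (ren-cong (λ i → sym (same-ren i)) P')))
    contract : plug E' (ren (ctxRen E') P') ⟶ P'
    contract = ⊥-red E' P' Γ (non-hole nh) (subst (Γ ⊢_∶ bot) X-redex (≋-typing d a)) (≋-typing dP P≋P')

  -- ≋ is a strong bisimulation for ⟶: swapping the arguments of a redex
  -- exchanges βˡ/βʳ, ηˡ/ηʳ and the two orientations of the π-rules
  ≋-bisim : ∀ {n} {u u' v : Tm n} → u ≋ u' → u ⟶ v → ∃ λ v' → (u' ⟶ v') × (v ≋ v')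
  ≋-bisim a (⊥-red E P Γ nh d dP) = ≋-⊥-redex E P Γ nh d dP a
  ≋-bisim (≋star (≋lam a) b) (βˡ _ _) = _ , βˡ _ _ , ≋-[≔] a b
  ≋-bisim (≋swap (≋lam a) b) (βˡ _ _) = _ , βʳ _ _ , ≋-[≔] a b
  ≋-bisim (≋star b (≋lam a)) (βʳ _ _) = _ , βʳ _ _ , ≋-[≔] a b
  ≋-bisim (≋swap b (≋lam a)) (βʳ _ _) = _ , βˡ _ _ , ≋-[≔] a b
  ≋-bisim (≋lam (≋star a (≋var .zero))) (ηˡ P) with ≋-unren suc P a
  ... | P' , refl , a' = P' , ηˡ P' , a'
  ≋-bisim (≋lam (≋swap a (≋var .zero))) (ηˡ P) with ≋-unren suc P a
  ... | P' , refl , a' = P' , ηʳ P' , a'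
  ≋-bisim (≋lam (≋star (≋var .zero) a)) (ηʳ P) with ≋-unren suc P a
  ... | P' , refl , a' = P' , ηʳ P' , a'
  ≋-bisim (≋lam (≋swap (≋var .zero) a)) (ηʳ P) with ≋-unren suc P a
  ... | P' , refl , a' = P' , ηˡ P' , a'
  ≋-bisim (≋star (≋pair a b) (≋σ₁ c)) (π₁ˡ _ _ _) = _ , π₁ˡ _ _ _ , ≋star a c
  ≋-bisim (≋swap (≋pair a b) (≋σ₁ c)) (π₁ˡ _ _ _) = _ , π₁ʳ _ _ _ , ≋swap a c
  ≋-bisim (≋star (≋pair a b) (≋σ₂ c)) (π₂ˡ _ _ _) = _ , π₂ˡ _ _ _ , ≋star b c
  ≋-bisim (≋swap (≋pair a b) (≋σ₂ c)) (π₂ˡ _ _ _) = _ , π₂ʳ _ _ _ , ≋swap b c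
  ≋-bisim (≋star (≋σ₁ c) (≋pair a b)) (π₁ʳ _ _ _) = _ , π₁ʳ _ _ _ , ≋star c a
  ≋-bisim (≋swap (≋σ₁ c) (≋pair a b)) (π₁ʳ _ _ _) = _ , π₁ˡ _ _ _ , ≋swap c a
  ≋-bisim (≋star (≋σ₂ c) (≋pair a b)) (π₂ʳ _ _ _) = _ , π₂ʳ _ _ _ , ≋star c b
  ≋-bisim (≋swap (≋σ₂ c) (≋pair a b)) (π₂ʳ _ _ _) = _ , π₂ˡ _ _ _ , ≋swap c b
  ≋-bisim (≋pair a b) (pairˡ _ s) = let (_ , s' , c) = ≋-bisim a s in _ , pairˡ _ s' , ≋pair c b
  ≋-bisim (≋pair a b) (pairʳ _ s) = let (_ , s' , c) = ≋-bisim b s in _ , pairʳ _ s' , ≋pair a c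
  ≋-bisim (≋σ₁ a)     (σ₁c s)     = let (_ , s' , c) = ≋-bisim a s in _ , σ₁c s' , ≋σ₁ c
  ≋-bisim (≋σ₂ a)     (σ₂c s)     = let (_ , s' , c) = ≋-bisim a s in _ , σ₂c s' , ≋σ₂ c
  ≋-bisim (≋lam a)    (lamc s)    = let (_ , s' , c) = ≋-bisim a s in _ , lamc s' , ≋lam c
  ≋-bisim (≋star a b) (starˡ _ s) = let (_ , s' , c) = ≋-bisim a s in _ , starˡ _ s' , ≋star c b
  ≋-bisim (≋swap a b) (starˡ _ s) = let (_ , s' , c) = ≋-bisim a s in _ , starʳ _ s' , ≋swap c b
  ≋-bisim (≋star a b) (starʳ _ s) = let (_ , s' , c) = ≋-bisim b s in _ , starʳ _ s' , ≋star a c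
  ≋-bisim (≋swap a b) (starʳ _ s) = let (_ , s' , c) = ≋-bisim b s in _ , starˡ _ s' , ≋swap a c

module Commutation where
  open Sym
  open SymSubstitution
  open SymTyping
  open SymReduction
  open Swapping

  LogicalFirst : ∀ {n} → Tm n → Tm n → Set
  LogicalFirst x z = ∃₂ λ w z' → (x →R w) × (w ⟶* z') × (z ≋ z')

  via-≋ : ∀ {n} {x y y' z : Tm n} → x →R y' → y ≋ y' → y ⟶ z → LogicalFirst x z
  via-≋ x→Ry' y≋y' y⟶z = let (z' , y'⟶z' , z≋z') = ≋-bisim y≋y' y⟶z in _ , z' , x→Ry' , return y'⟶z' , z≋z'

  LogicalFirst-map : ∀ {n n'} (f : Tm n → Tm n') → (∀ {P Q} → P →R Q → f P →R f Q) →
                     (∀ {P Q} → P ⟶ Q → f P ⟶ f Q) → (∀ {P Q} → P ≋ Q → f P ≋ f Q) →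
                     ∀ {x z} → LogicalFirst x z → LogicalFirst (f x) (f z)
  LogicalFirst-map f fR f⟶ f≋ (w , z' , x→Rw , w⟶*z' , z≋z') = f w , f z' , fR x→Rw , gmap f f⟶ w⟶*z' , f≋ z≋z'

  -- an η-redex as an argument of ⋆ can instead be consumed by a β-step
  βˡ-on-ηˡ : ∀ {n} (M Q : Tm n) → lam (wk M ⋆ var zero) ⋆ Q →R M ⋆ Q
  βˡ-on-ηˡ M Q = subst (lam (wk M ⋆ var zero) ⋆ Q →R_) (cong (_⋆ Q) (wk-[≔] M Q)) (root (βˡ _ Q))

  βˡ-on-ηʳ : ∀ {n} (M Q : Tm n) → lam (var zero ⋆ wk M) ⋆ Q →R Q ⋆ M
  βˡ-on-ηʳ M Q = subst (lam (var zero ⋆ wk M) ⋆ Q →R_) (cong (Q ⋆_) (wk-[≔] M Q)) (root (βˡ _ Q))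

  βʳ-on-ηˡ : ∀ {n} (P M : Tm n) → P ⋆ lam (wk M ⋆ var zero) →R M ⋆ P
  βʳ-on-ηˡ P M = subst (P ⋆ lam (wk M ⋆ var zero) →R_) (cong (_⋆ P) (wk-[≔] M P)) (root (βʳ _ P))

  βʳ-on-ηʳ : ∀ {n} (P M : Tm n) → P ⋆ lam (var zero ⋆ wk M) →R P ⋆ M
  βʳ-on-ηʳ P M = subst (P ⋆ lam (var zero ⋆ wk M) →R_) (cong (P ⋆_) (wk-[≔] M P)) (root (βʳ _ P))

  root-first : ∀ {n} {x y z : Tm n} → x ▷S y → y →R z → LogicalFirst x z
  root-first (ηˡ P) r = _ , _ , inLam (inStarˡ _ (→R-ren suc r)) , return (ηˡ _) , ≋-refl
  root-first (ηʳ P) r = _ , _ , inLam (inStarʳ _ (→R-ren suc r)) , return (ηʳ _) , ≋-refl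
  root-first (⊥-red E P Γ nh d dP) r = _ , _ , E[r] , return (⊥-red E _ Γ nh (→R-typing d E[r]) (→R-typing dP r)) , ≋-refl
    where
    E[r] : plug E (ren (ctxRen E) P) →R plug E (ren (ctxRen E) _)
    E[r] = compat-plug E (→R-ren (ctxRen E) r)

  left-first : ∀ {n} {Γ : Vec MTy n} {A A' B z T} → Γ ⊢ A ⋆ B ∶ T → A →S A' → A' ⋆ B ▷R z →
               LogicalFirst (A ⋆ B) z
  left-first (star dA dL) s (βʳ C _) = _ , _ , root (βʳ C _) , →S*⇒⟶* ([≔]-→S* (lam⁻¹ dL) dA s) , ≋-refl
  left-first d (root (ηˡ M)) r = via-≋ (βˡ-on-ηˡ M _) ≋-refl (→R⇒⟶ (root r))
  left-first d (root (ηʳ M)) r = via-≋ (βˡ-on-ηʳ M _) (≋-swap M _) (→R⇒⟶ (root r))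
  left-first d (root (⊥-red E _ Γ nh d₀ ())) (βˡ _ _)
  left-first d (root (⊥-red E _ Γ nh d₀ ())) (π₁ˡ _ _ _)
  left-first d (root (⊥-red E _ Γ nh d₀ ())) (π₂ˡ _ _ _)
  left-first d (root (⊥-red E _ Γ nh d₀ ())) (π₁ʳ _ _ _)
  left-first d (root (⊥-red E _ Γ nh d₀ ())) (π₂ʳ _ _ _)
  left-first (star dL dB) (inLam s) (βˡ _ _) = _ , _ , root (βˡ _ _) , return (→S⇒⟶ ([≔]-→S (lam⁻¹-neg dL) dB s)) , ≋-refl
  left-first d (inPairˡ _ s) (π₁ˡ _ _ _) = _ , _ , root (π₁ˡ _ _ _) , return (starˡ _ (→S⇒⟶ s)) , ≋-refl
  left-first d (inPairʳ _ s) (π₁ˡ _ _ _) = _ , _ , root (π₁ˡ _ _ _) , ε , ≋-refl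
  left-first d (inPairˡ _ s) (π₂ˡ _ _ _) = _ , _ , root (π₂ˡ _ _ _) , ε , ≋-refl
  left-first d (inPairʳ _ s) (π₂ˡ _ _ _) = _ , _ , root (π₂ˡ _ _ _) , return (starˡ _ (→S⇒⟶ s)) , ≋-refl
  left-first d (inσ₁ s) (π₁ʳ _ _ _) = _ , _ , root (π₁ʳ _ _ _) , return (starˡ _ (→S⇒⟶ s)) , ≋-refl
  left-first d (inσ₂ s) (π₂ʳ _ _ _) = _ , _ , root (π₂ʳ _ _ _) , return (starˡ _ (→S⇒⟶ s)) , ≋-refl

  right-first : ∀ {n} {Γ : Vec MTy n} {A B B' z T} → Γ ⊢ A ⋆ B ∶ T → B →S B' → A ⋆ B' ▷R z →
                LogicalFirst (A ⋆ B) z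
  right-first (star dL dB) s (βˡ C _) = _ , _ , root (βˡ C _) , →S*⇒⟶* ([≔]-→S* (lam⁻¹-neg dL) dB s) , ≋-refl
  right-first d (root (ηˡ M)) r = via-≋ (βʳ-on-ηˡ _ M) (≋-swap _ M) (→R⇒⟶ (root r))
  right-first d (root (ηʳ M)) r = via-≋ (βʳ-on-ηʳ _ M) ≋-refl (→R⇒⟶ (root r))
  right-first d (root (⊥-red E _ Γ nh d₀ ())) (βʳ _ _)
  right-first d (root (⊥-red E _ Γ nh d₀ ())) (π₁ˡ _ _ _)
  right-first d (root (⊥-red E _ Γ nh d₀ ())) (π₂ˡ _ _ _)
  right-first d (root (⊥-red E _ Γ nh d₀ ())) (π₁ʳ _ _ _)
  right-first d (root (⊥-red E _ Γ nh d₀ ())) (π₂ʳ _ _ _)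
  right-first (star dA dL) (inLam s) (βʳ _ _) = _ , _ , root (βʳ _ _) , return (→S⇒⟶ ([≔]-→S (lam⁻¹ dL) dA s)) , ≋-refl
  right-first d (inσ₁ s) (π₁ˡ _ _ _) = _ , _ , root (π₁ˡ _ _ _) , return (starʳ _ (→S⇒⟶ s)) , ≋-refl
  right-first d (inσ₂ s) (π₂ˡ _ _ _) = _ , _ , root (π₂ˡ _ _ _) , return (starʳ _ (→S⇒⟶ s)) , ≋-refl
  right-first d (inPairˡ _ s) (π₁ʳ _ _ _) = _ , _ , root (π₁ʳ _ _ _) , return (starʳ _ (→S⇒⟶ s)) , ≋-refl
  right-first d (inPairʳ _ s) (π₁ʳ _ _ _) = _ , _ , root (π₁ʳ _ _ _) , ε , ≋-refl
  right-first d (inPairˡ _ s) (π₂ʳ _ _ _) = _ , _ , root (π₂ʳ _ _ _) , ε , ≋-refl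
  right-first d (inPairʳ _ s) (π₂ʳ _ _ _) = _ , _ , root (π₂ʳ _ _ _) , return (starʳ _ (→S⇒⟶ s)) , ≋-refl

  commute : ∀ {n} {Γ : Vec MTy n} {x y z T} → Γ ⊢ x ∶ T → x →S y → y →R z → LogicalFirst x z
  commute d (root s) r = root-first s r
  commute d (inStarˡ _ s) (root r) = left-first d s r
  commute d (inStarʳ _ s) (root r) = right-first d s r
  commute (pair d _) (inPairˡ Q s) (inPairˡ _ r) =
    LogicalFirst-map (λ X → pair X Q) (inPairˡ Q) (pairˡ Q) (λ a → ≋pair a ≋-refl) (commute d s r)
  commute (pair _ e) (inPairʳ P s) (inPairʳ _ r) =
    LogicalFirst-map (pair P) (inPairʳ P) (pairʳ P) (≋pair ≋-refl) (commute e s r)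
  commute (inj₁ d) (inσ₁ s) (inσ₁ r) = LogicalFirst-map σ₁ inσ₁ σ₁c ≋σ₁ (commute d s r)
  commute (inj₂ d) (inσ₂ s) (inσ₂ r) = LogicalFirst-map σ₂ inσ₂ σ₂c ≋σ₂ (commute d s r)
  commute (lam d)  (inLam s) (inLam r) = LogicalFirst-map lam inLam lamc ≋lam (commute d s r)
  commute (star d _) (inStarˡ Q s) (inStarˡ _ r) =
    LogicalFirst-map (_⋆ Q) (inStarˡ Q) (starˡ Q) (λ a → ≋star a ≋-refl) (commute d s r)
  commute (star _ e) (inStarʳ P s) (inStarʳ _ r) =
    LogicalFirst-map (P ⋆_) (inStarʳ P) (starʳ P) (≋star ≋-refl) (commute e s r)
  commute d (inPairˡ _ s) (inPairʳ _ r) = _ , _ , inPairʳ _ r , return (pairˡ _ (→S⇒⟶ s)) , ≋-refl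
  commute d (inPairʳ _ s) (inPairˡ _ r) = _ , _ , inPairˡ _ r , return (pairʳ _ (→S⇒⟶ s)) , ≋-refl
  commute d (inStarˡ _ s) (inStarʳ _ r) = _ , _ , inStarʳ _ r , return (starˡ _ (→S⇒⟶ s)) , ≋-refl
  commute d (inStarʳ _ s) (inStarˡ _ r) = _ , _ , inStarˡ _ r , return (starʳ _ (→S⇒⟶ s)) , ≋-refl

SN-from-logical : ∀ {n} {Γ : Vec Sym.MTy n} {P T} → Γ Sym.⊢ P ∶ T →
                  Acc (λ Q P → P SymReduction.→R Q) P → Sym.SN P
SN-from-logical {n} {Γ} {T = T} d =
  Postponement.SN-from-logical (λ P → Γ Sym.⊢ P ∶ T) Sym._⟶_ _→R_ _→S_ _≋_ size split
    →R-typing →S-typing →S-size ≋-refl ≋-trans ≋-bisim commute d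
  where
  open SymReduction
  open Swapping
  open Commutation

module LMMSubstitution where
  open LMM

  liftx-cong : ∀ {n n' m'} {σ σ' : Fin n → Tm n' m'} → (∀ i → σ i ≡ σ' i) → ∀ i → liftx σ i ≡ liftx σ' i
  liftx-cong eq zero    = refl
  liftx-cong eq (suc i) = cong wkTx (eq i)

  liftα-cong : ∀ {m n' m'} {τ τ' : Fin m → CoTm n' m'} → (∀ j → τ j ≡ τ' j) → ∀ j → liftα τ j ≡ liftα τ' j
  liftα-cong eq zero    = refl
  liftα-cong eq (suc j) = cong wkEα (eq j)

  subC-cong : ∀ {n m n' m'} {σ σ' : Fin n → Tm n' m'} {τ τ' : Fin m → CoTm n' m'} →
              (∀ i → σ i ≡ σ' i) → (∀ j → τ j ≡ τ' j) → ∀ p → subC σ τ p ≡ subC σ' τ' p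
  subT-cong : ∀ {n m n' m'} {σ σ' : Fin n → Tm n' m'} {τ τ' : Fin m → CoTm n' m'} →
              (∀ i → σ i ≡ σ' i) → (∀ j → τ j ≡ τ' j) → ∀ t → subT σ τ t ≡ subT σ' τ' t
  subE-cong : ∀ {n m n' m'} {σ σ' : Fin n → Tm n' m'} {τ τ' : Fin m → CoTm n' m'} →
              (∀ i → σ i ≡ σ' i) → (∀ j → τ j ≡ τ' j) → ∀ e → subE σ τ e ≡ subE σ' τ' e
  subC-cong a b ⌊ t , e ⌋ = cong₂ ⌊_,_⌋ (subT-cong a b t) (subE-cong a b e)
  subT-cong a b (var x)   = a x
  subT-cong a b (lam t)   = cong lam (subT-cong (liftx-cong a) (λ j → cong wkEx (b j)) t)
  subT-cong a b (mu p)    = cong mu (subC-cong (λ i → cong wkTα (a i)) (liftα-cong b) p)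
  subT-cong a b (bar e)   = cong bar (subE-cong a b e)
  subE-cong a b (covar α) = b α
  subE-cong a b (t · e)   = cong₂ _·_ (subT-cong a b t) (subE-cong a b e)
  subE-cong a b (mut p)   = cong mut (subC-cong (liftx-cong a) (λ j → cong wkEx (b j)) p)
  subE-cong a b (tld t)   = cong tld (subT-cong a b t)

  subx₀ : ∀ {n m} → Tm n m → Fin (suc n) → Tm n m
  subx₀ t zero    = t
  subx₀ t (suc i) = var i

  subα₀ : ∀ {n m} → CoTm n m → Fin (suc m) → CoTm n m
  subα₀ e zero    = e
  subα₀ e (suc j) = covar j

  [x≔]-subx₀ : ∀ {n m} (p : Cmd (suc n) m) t → p [x≔ t ] ≡ subC (subx₀ t) covar p
  [x≔]-subx₀ p t = subC-cong (λ { zero → refl ; (suc i) → refl }) (λ _ → refl) p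

  [α≔]-subα₀ : ∀ {n m} (p : Cmd n (suc m)) e → p [α≔ e ] ≡ subC var (subα₀ e) p
  [α≔]-subα₀ p e = subC-cong (λ _ → refl) (λ { zero → refl ; (suc j) → refl }) p

  renC-typing : ∀ {n m n' m'} {Γ : Vec Ty n} {Δ : Vec Ty m} {Γ' : Vec Ty n'} {Δ' : Vec Ty m'} {ρ ϱ} →
                (∀ i → lookup Γ' (ρ i) ≡ lookup Γ i) → (∀ j → lookup Δ' (ϱ j) ≡ lookup Δ j) →
                ∀ {p} → ⊢C Γ Δ p → ⊢C Γ' Δ' (renC ρ ϱ p)
  renT-typing : ∀ {n m n' m'} {Γ : Vec Ty n} {Δ : Vec Ty m} {Γ' : Vec Ty n'} {Δ' : Vec Ty m'} {ρ ϱ} →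
                (∀ i → lookup Γ' (ρ i) ≡ lookup Γ i) → (∀ j → lookup Δ' (ϱ j) ≡ lookup Δ j) →
                ∀ {t A} → ⊢T Γ Δ t A → ⊢T Γ' Δ' (renT ρ ϱ t) A
  renE-typing : ∀ {n m n' m'} {Γ : Vec Ty n} {Δ : Vec Ty m} {Γ' : Vec Ty n'} {Δ' : Vec Ty m'} {ρ ϱ} →
                (∀ i → lookup Γ' (ρ i) ≡ lookup Γ i) → (∀ j → lookup Δ' (ϱ j) ≡ lookup Δ j) →
                ∀ {e A} → ⊢E Γ Δ e A → ⊢E Γ' Δ' (renE ρ ϱ e) A
  renC-typing a b (cut d e) = cut (renT-typing a b d) (renE-typing a b e)
  renT-typing {Γ' = Γ'} {Δ'} {ρ} a b (ax x) = subst (⊢T Γ' Δ' (var (ρ x))) (a x) (ax (ρ x))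
  renT-typing a b (lam d) = lam (renT-typing (λ { zero → refl ; (suc i) → a i }) b d)
  renT-typing a b (mu d)  = mu (renC-typing a (λ { zero → refl ; (suc j) → b j }) d)
  renT-typing a b (bar d) = bar (renE-typing a b d)
  renE-typing {Γ' = Γ'} {Δ'} {ϱ = ϱ} a b (ax α) = subst (⊢E Γ' Δ' (covar (ϱ α))) (b α) (ax (ϱ α))
  renE-typing a b (app d e) = app (renT-typing a b d) (renE-typing a b e)
  renE-typing a b (mut d)   = mut (renC-typing (λ { zero → refl ; (suc i) → a i }) b d)
  renE-typing a b (tld d)   = tld (renT-typing a b d)

  wkTx-typing : ∀ {n m} {Γ : Vec Ty n} {Δ : Vec Ty m} {t A} B → ⊢T Γ Δ t A → ⊢T (B ∷ Γ) Δ (wkTx t) A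
  wkTx-typing B = renT-typing (λ _ → refl) (λ _ → refl)

-- It is a relation because both orientations of a cut translate P ⋆ Q, and
-- the translation of Q in σ₁ Q may live under an extra co-variable.
module Translation where
  open LMM
  open LMMSubstitution
  open SymSubstitution using (ren-id; ren-ext-wk; sub-lift-wk; sub-id; sub-wk; sub₀; [≔]-sub₀)
  open SymReduction using (_→R_; _▷R_; βˡ; βʳ; π₁ˡ; π₂ˡ; π₁ʳ; π₂ʳ; root; inPairˡ; inPairʳ; inσ₁; inσ₂; inLam; inStarˡ; inStarʳ; →R-ren)
  module S = Sym

  data Tr : ∀ {n m} → S.Tm n → Tm n m → Set
  data TrC : ∀ {n m} → S.Tm n → Cmd n m → Set

  data Tr where
    tvar  : ∀ {n m} (x : Fin n) → Tr {n} {m} (S.var x) (var x)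
    tlam  : ∀ {n m} {P} {c : Cmd (suc n) m} → TrC P c → Tr (S.lam P) (bar (mut c))
    tpair : ∀ {n m} {P₁ P₂} {p₁ p₂ : Tm n m} → Tr P₁ p₁ → Tr P₂ p₂ → Tr (S.pair P₁ P₂) (bar (p₁ · tld p₂))
    tσ₁   : ∀ {n m} {Q : S.Tm n} {q : Tm (suc n) (suc m)} → Tr (S.wk Q) q →
            Tr (S.σ₁ Q) (lam (mu ⌊ q , tld (var zero) ⌋))
    tσ₂   : ∀ {n m} {Q : S.Tm n} {q : Tm (suc n) m} → Tr (S.wk Q) q → Tr (S.σ₂ Q) (lam q)

  data TrC where
    tstar₁ : ∀ {n m} {P Q} {p q : Tm n m} → Tr P p → Tr Q q → TrC (P S.⋆ Q) ⌊ q , tld p ⌋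
    tstar₂ : ∀ {n m} {P Q} {p q : Tm n m} → Tr P p → Tr Q q → TrC (P S.⋆ Q) ⌊ p , tld q ⌋

  Tr-cast : ∀ {n m} {P P' : S.Tm n} {t : Tm n m} → P ≡ P' → Tr P t → Tr P' t
  Tr-cast refl a = a

  -- Translations are stable under renaming (ρS and ρ are the same renaming,
  -- acting on the two calculi).
  Tr-ren  : ∀ {n m n' m'} (ρS ρ : Fin n → Fin n') → (∀ i → ρS i ≡ ρ i) → (ϱ : Fin m → Fin m') →
            ∀ {P t} → Tr P t → Tr (S.ren ρS P) (renT ρ ϱ t)
  TrC-ren : ∀ {n m n' m'} (ρS ρ : Fin n → Fin n') → (∀ i → ρS i ≡ ρ i) → (ϱ : Fin m → Fin m') →
            ∀ {P c} → TrC P c → TrC (S.ren ρS P) (renC ρ ϱ c)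
  Tr-ren ρS ρ eq ϱ (tvar x) = subst (λ y → Tr (S.var y) (var (ρ x))) (sym (eq x)) (tvar (ρ x))
  Tr-ren ρS ρ eq ϱ (tlam c) = tlam (TrC-ren (S.ext ρS) (ext ρ) (λ { zero → refl ; (suc i) → cong suc (eq i) }) ϱ c)
  Tr-ren ρS ρ eq ϱ (tpair a b) = tpair (Tr-ren ρS ρ eq ϱ a) (Tr-ren ρS ρ eq ϱ b)
  Tr-ren ρS ρ eq ϱ (tσ₁ {Q = Q} a) =
    tσ₁ (Tr-cast (ren-ext-wk ρS Q) (Tr-ren (S.ext ρS) (ext ρ) (λ { zero → refl ; (suc i) → cong suc (eq i) }) (ext ϱ) a))
  Tr-ren ρS ρ eq ϱ (tσ₂ {Q = Q} a) =
    tσ₂ (Tr-cast (ren-ext-wk ρS Q) (Tr-ren (S.ext ρS) (ext ρ) (λ { zero → refl ; (suc i) → cong suc (eq i) }) ϱ a))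
  TrC-ren ρS ρ eq ϱ (tstar₁ a b) = tstar₁ (Tr-ren ρS ρ eq ϱ a) (Tr-ren ρS ρ eq ϱ b)
  TrC-ren ρS ρ eq ϱ (tstar₂ a b) = tstar₂ (Tr-ren ρS ρ eq ϱ a) (Tr-ren ρS ρ eq ϱ b)

  Tr-wkx : ∀ {n m} {P : S.Tm n} {t : Tm n m} → Tr P t → Tr (S.wk P) (wkTx t)
  Tr-wkx = Tr-ren suc suc (λ _ → refl) (λ α → α)

  Tr-wkα : ∀ {n m} {P : S.Tm n} {t : Tm n m} → Tr P t → Tr P (wkTα t)
  Tr-wkα {P = P} a = Tr-cast (ren-id (λ _ → refl) P) (Tr-ren (λ x → x) (λ x → x) (λ _ → refl) suc a)

  -- Translations are stable under substitution; since translations contain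
  -- no co-variables, the substitution τ for co-variables is arbitrary.
  Tr-sub  : ∀ {n m n' m'} {σS : Fin n → S.Tm n'} {σ : Fin n → Tm n' m'} (τ : Fin m → CoTm n' m') →
            (∀ i → Tr (σS i) (σ i)) → ∀ {P t} → Tr P t → Tr (S.sub σS P) (subT σ τ t)
  TrC-sub : ∀ {n m n' m'} {σS : Fin n → S.Tm n'} {σ : Fin n → Tm n' m'} (τ : Fin m → CoTm n' m') →
            (∀ i → Tr (σS i) (σ i)) → ∀ {P c} → TrC P c → TrC (S.sub σS P) (subC σ τ c)
  Tr-sub τ h (tvar x) = h x
  Tr-sub τ h (tlam c) = tlam (TrC-sub _ (λ { zero → tvar zero ; (suc i) → Tr-wkx (h i) }) c)
  Tr-sub τ h (tpair a b) = tpair (Tr-sub τ h a) (Tr-sub τ h b)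
  Tr-sub {σS = σS} τ h (tσ₁ {Q = Q} a) =
    tσ₁ (Tr-cast (sub-lift-wk σS Q) (Tr-sub _ (λ { zero → tvar zero ; (suc i) → Tr-wkα (Tr-wkx (h i)) }) a))
  Tr-sub {σS = σS} τ h (tσ₂ {Q = Q} a) =
    tσ₂ (Tr-cast (sub-lift-wk σS Q) (Tr-sub _ (λ { zero → tvar zero ; (suc i) → Tr-wkx (h i) }) a))
  TrC-sub τ h (tstar₁ a b) = tstar₁ (Tr-sub τ h a) (Tr-sub τ h b)
  TrC-sub τ h (tstar₂ a b) = tstar₂ (Tr-sub τ h a) (Tr-sub τ h b)

  Tr-sub₀-wk : ∀ {n m} {P : S.Tm n} {Q} {p : Tm (suc n) m} {q} (τ : Fin m → CoTm n m) →
               Tr (S.wk P) p → Tr Q q → Tr P (subT (subx₀ q) τ p)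
  Tr-sub₀-wk {P = P} {Q} τ a b =
    Tr-cast (sub-wk (sub₀ Q) (λ _ → refl) P) (Tr-sub τ (λ { zero → b ; (suc i) → tvar i }) a)

  Tr-subα : ∀ {n m m'} {P : S.Tm n} {p : Tm n m} (τ : Fin m → CoTm n m') → Tr P p → Tr P (subT var τ p)
  Tr-subα {P = P} τ a = Tr-cast (sub-id (λ _ → refl) P) (Tr-sub τ tvar a)

  _↪C⁺_ : ∀ {n m} → Cmd n m → Cmd n m → Set
  _↪C⁺_ = TransClosure _↪C_

  _↪T⁺_ : ∀ {n m} → Tm n m → Tm n m → Set
  _↪T⁺_ = TransClosure _↪T_

  _↪C≡_ : ∀ {n m} {c c' c'' : Cmd n m} → c ↪C c' → c' ≡ c'' → c ↪C c''
  s ↪C≡ refl = s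

  β-chain : ∀ {n m} {P : S.Tm (suc n)} {Q} {cP : Cmd (suc n) m} {q} → TrC P cP → Tr Q q →
            ∃ λ c → (⌊ q , mut cP ⌋ ↪C⁺ c) × TrC (P S.[≔ Q ]) c
  β-chain {P = P} {Q} {cP} {q} tc a =
    _ , [ βμ̃ q cP ↪C≡ [x≔]-subx₀ cP q ] ,
    subst (λ X → TrC X _) (sym ([≔]-sub₀ P Q)) (TrC-sub covar (λ { zero → a ; (suc i) → tvar i }) tc)

  π₁-chain : ∀ {n m} {Q P₁ P₂ : S.Tm n} {q : Tm (suc n) (suc m)} {p₁ p₂ : Tm n m} →
             Tr (S.wk Q) q → Tr P₁ p₁ → Tr P₂ p₂ →
             ∃₂ λ q₀ p₀ → (⌊ lam (mu ⌊ q , tld (var zero) ⌋) , p₁ · tld p₂ ⌋ ↪C⁺ ⌊ q₀ , tld p₀ ⌋) × Tr Q q₀ × Tr P₁ p₀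
  π₁-chain {Q = Q} {P₁} {q = q} {p₁} {p₂} aq a₁ a₂ =
    _ , _ ,
    βλ (mu ⌊ q , tld (var zero) ⌋) p₁ (tld p₂) ∷
    (βμ̃ p₁ _ ↪C≡ [x≔]-subx₀ ⌊ mu ⌊ q , tld (var zero) ⌋ , wkEx (tld p₂) ⌋ p₁) ∷
    [ βμ body e ↪C≡ [α≔]-subα₀ body e ] ,
    Tr-subα (subα₀ e) (Tr-cast (sub-wk (sub₀ P₁) (λ _ → refl) Q)
      (Tr-sub (liftα covar) (λ { zero → Tr-wkα a₁ ; (suc i) → tvar i }) aq)) ,
    Tr-subα (subα₀ e) (Tr-wkα a₁)
    where
    body = subC (λ i → wkTα (subx₀ p₁ i)) (liftα covar) ⌊ q , tld (var zero) ⌋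
    e    = subE (subx₀ p₁) covar (wkEx (tld p₂))

  π₂-chain : ∀ {n m} {Q P₁ P₂ : S.Tm n} {q : Tm (suc n) m} {p₁ p₂ : Tm n m} →
             Tr (S.wk Q) q → Tr P₁ p₁ → Tr P₂ p₂ →
             ∃₂ λ q₀ p₀ → (⌊ lam q , p₁ · tld p₂ ⌋ ↪C⁺ ⌊ q₀ , tld p₀ ⌋) × Tr Q q₀ × Tr P₂ p₀
  π₂-chain {q = q} {p₁} {p₂} aq a₁ a₂ =
    _ , _ ,
    βλ q p₁ (tld p₂) ∷ [ βμ̃ p₁ _ ↪C≡ [x≔]-subx₀ ⌊ q , wkEx (tld p₂) ⌋ p₁ ] ,
    Tr-sub₀-wk covar aq a₁ ,
    Tr-sub₀-wk covar (Tr-wkx a₂) a₁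

  ⁺-map : ∀ {A B : Set} {R : A → A → Set} {R' : B → B → Set} (f : A → B) →
          (∀ {x y} → R x y → R' (f x) (f y)) → ∀ {x y} → TransClosure R x y → TransClosure R' (f x) (f y)
  ⁺-map f g [ s ]   = [ g s ]
  ⁺-map f g (s ∷ p) = g s ∷ ⁺-map f g p

  SimT : ∀ {n m} → S.Tm n → Tm n m → Set
  SimT P' t = ∃ λ t' → (t ↪T⁺ t') × Tr P' t'

  SimC : ∀ {n m} → S.Tm n → Cmd n m → Set
  SimC P' c = ∃ λ c' → (c ↪C⁺ c') × TrC P' c'

  _◅Sim_ : ∀ {n m} {P'} {c c₁ : Cmd n m} → c ↪C c₁ → SimC P' c₁ → SimC P' c
  s ◅Sim (c' , p , a) = c' , s ∷ p , a

  -- Simulation of logical root steps.  The first step of each chain turns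
  -- the translated cut into a redex (removing an overline/tilde pair).
  simC-root : ∀ {n m} {P P' : S.Tm n} {c : Cmd n m} → TrC P c → P ▷R P' → SimC P' c
  simC-root (tstar₁ (tlam tc) b) (βˡ _ _) = cutʳ _ (tldbar _) ◅Sim β-chain tc b
  simC-root (tstar₂ (tlam tc) b) (βˡ _ _) = βbt _ _ ◅Sim β-chain tc b
  simC-root (tstar₁ a (tlam tc)) (βʳ _ _) = βbt _ _ ◅Sim β-chain tc a
  simC-root (tstar₂ a (tlam tc)) (βʳ _ _) = cutʳ _ (tldbar _) ◅Sim β-chain tc a
  simC-root (tstar₁ (tpair a₁ a₂) (tσ₁ aq)) (π₁ˡ _ _ _) =
    let (_ , _ , ch , bq , bp) = π₁-chain aq a₁ a₂ in _ , cutʳ _ (tldbar _) ∷ ch , tstar₁ bp bq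
  simC-root (tstar₂ (tpair a₁ a₂) (tσ₁ aq)) (π₁ˡ _ _ _) =
    let (_ , _ , ch , bq , bp) = π₁-chain aq a₁ a₂ in _ , βbt _ _ ∷ ch , tstar₁ bp bq
  simC-root (tstar₁ (tpair a₁ a₂) (tσ₂ aq)) (π₂ˡ _ _ _) =
    let (_ , _ , ch , bq , bp) = π₂-chain aq a₁ a₂ in _ , cutʳ _ (tldbar _) ∷ ch , tstar₁ bp bq
  simC-root (tstar₂ (tpair a₁ a₂) (tσ₂ aq)) (π₂ˡ _ _ _) =
    let (_ , _ , ch , bq , bp) = π₂-chain aq a₁ a₂ in _ , βbt _ _ ∷ ch , tstar₁ bp bq
  simC-root (tstar₁ (tσ₁ aq) (tpair a₁ a₂)) (π₁ʳ _ _ _) =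
    let (_ , _ , ch , bq , bp) = π₁-chain aq a₁ a₂ in _ , βbt _ _ ∷ ch , tstar₂ bq bp
  simC-root (tstar₂ (tσ₁ aq) (tpair a₁ a₂)) (π₁ʳ _ _ _) =
    let (_ , _ , ch , bq , bp) = π₁-chain aq a₁ a₂ in _ , cutʳ _ (tldbar _) ∷ ch , tstar₂ bq bp
  simC-root (tstar₁ (tσ₂ aq) (tpair a₁ a₂)) (π₂ʳ _ _ _) =
    let (_ , _ , ch , bq , bp) = π₂-chain aq a₁ a₂ in _ , βbt _ _ ∷ ch , tstar₂ bq bp
  simC-root (tstar₂ (tσ₂ aq) (tpair a₁ a₂)) (π₂ʳ _ _ _) =
    let (_ , _ , ch , bq , bp) = π₂-chain aq a₁ a₂ in _ , cutʳ _ (tldbar _) ∷ ch , tstar₂ bq bp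

  sim  : ∀ {n m} {P P' : S.Tm n} {t : Tm n m} → Tr P t → P →R P' → SimT P' t
  simC : ∀ {n m} {P P' : S.Tm n} {c : Cmd n m} → TrC P c → P →R P' → SimC P' c
  sim (tvar x) (root ())
  sim (tlam tc) (inLam r) =
    let (_ , p , tc') = simC tc r in _ , ⁺-map (λ c → bar (mut c)) (λ s → barc (mutc s)) p , tlam tc'
  sim (tpair {p₂ = p₂} a b) (inPairˡ _ r) =
    let (_ , p , a') = sim a r in _ , ⁺-map (λ t → bar (t · tld p₂)) (λ s → barc (appˡ _ s)) p , tpair a' b
  sim (tpair {p₁ = p₁} a b) (inPairʳ _ r) =
    let (_ , p , b') = sim b r in _ , ⁺-map (λ t → bar (p₁ · tld t)) (λ s → barc (appʳ _ (tldc s))) p , tpair a b'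
  sim (tσ₁ a) (inσ₁ r) =
    let (_ , p , a') = sim a (→R-ren suc r) in
    _ , ⁺-map (λ t → lam (mu ⌊ t , tld (var zero) ⌋)) (λ s → lamc (muc (cutˡ _ s))) p , tσ₁ a'
  sim (tσ₂ a) (inσ₂ r) =
    let (_ , p , a') = sim a (→R-ren suc r) in _ , ⁺-map lam lamc p , tσ₂ a'
  simC c (root r) = simC-root c r
  simC (tstar₁ {q = q} a b) (inStarˡ _ r) =
    let (_ , p , a') = sim a r in _ , ⁺-map (λ t → ⌊ q , tld t ⌋) (λ s → cutʳ _ (tldc s)) p , tstar₁ a' b
  simC (tstar₁ {p = p₀} a b) (inStarʳ _ r) =
    let (_ , p , b') = sim b r in _ , ⁺-map (λ t → ⌊ t , tld p₀ ⌋) (cutˡ _) p , tstar₁ a b'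
  simC (tstar₂ {q = q} a b) (inStarˡ _ r) =
    let (_ , p , a') = sim a r in _ , ⁺-map (λ t → ⌊ t , tld q ⌋) (cutˡ _) p , tstar₂ a' b
  simC (tstar₂ {p = p₀} a b) (inStarʳ _ r) =
    let (_ , p , b') = sim b r in _ , ⁺-map (λ t → ⌊ p₀ , tld t ⌋) (λ s → cutʳ _ (tldc s)) p , tstar₂ a b'

  reverse⁺ : ∀ {A : Set} {R : A → A → Set} {x y} → TransClosure R x y → TransClosure (λ b a → R a b) y x
  reverse⁺ [ s ]   = [ s ]
  reverse⁺ (s ∷ p) = reverse⁺ p ∷ʳ s

  AccR : ∀ {n} → S.Tm n → Set
  AccR = Acc (λ Q P → P →R Q)

  AccR-from-SNT : ∀ {n m} {P : S.Tm n} {t : Tm n m} → Acc (TransClosure (λ u t → t ↪T u)) t → Tr P t → AccR P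
  AccR-from-SNT (acc rs) a = acc λ r → let (_ , p , a') = sim a r in AccR-from-SNT (rs (reverse⁺ p)) a'

  AccR-from-SNC : ∀ {n m} {P : S.Tm n} {c : Cmd n m} → Acc (TransClosure (λ d c → c ↪C d)) c → TrC P c → AccR P
  AccR-from-SNC (acc rs) a = acc λ r → let (_ , p , a') = simC a r in AccR-from-SNC (rs (reverse⁺ p)) a'

  ty : S.MTy → Ty
  ty (S.at k)   = at k
  ty (S.coat k) = dual (at k)
  ty (A S.∧ B)  = dual (ty A ⟶ dual (ty B))
  ty (A S.∨ B)  = dual (ty A) ⟶ ty B

  dual-involutive : ∀ A → dual (dual A) ≡ A
  dual-involutive (pos P) = refl
  dual-involutive (neg P) = refl

  ty-neg : ∀ A → ty (S.neg A) ≡ dual (ty A)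
  ty-neg (S.at k)   = refl
  ty-neg (S.coat k) = refl
  ty-neg (A S.∧ B)  = cong₂ _⟶_ (trans (cong dual (ty-neg A)) (dual-involutive _)) (ty-neg B)
  ty-neg (A S.∨ B)  = cong dual (cong₂ _⟶_ (ty-neg A) (trans (cong dual (ty-neg B)) (dual-involutive _)))

  Translated : ∀ {n} → Vec S.MTy n → ∀ {m} → Vec Ty m → S.Tm n → S.STy → Set
  Translated {n} Γ {m} Δ P (S.m A) = ∃ λ (t : Tm n m) → Tr P t × ⊢T (map ty Γ) Δ t (ty A)
  Translated {n} Γ {m} Δ P S.bot   = ∃ λ (c : Cmd n m) → TrC P c × ⊢C (map ty Γ) Δ c

  translate : ∀ {n} {Γ : Vec S.MTy n} {P T} → Γ S.⊢ P ∶ T → ∀ {m} (Δ : Vec Ty m) → Translated Γ Δ P T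
  translate {Γ = Γ} (S.ax x) Δ =
    var x , tvar x , subst (⊢T (map ty Γ) Δ (var x)) (lookup-map x ty Γ) (ax x)
  translate (S.pair d e) Δ =
    let (p₁ , a₁ , d₁) = translate d Δ ; (p₂ , a₂ , d₂) = translate e Δ in
    bar (p₁ · tld p₂) , tpair a₁ a₂ , bar (app d₁ (tld d₂))
  translate {Γ = Γ} (S.inj₁ {A₁ = A₁} {A₂} d) Δ =
    let (q , a , dq) = translate d (ty A₂ ∷ Δ)
        dy : ⊢E (dual (ty A₁) ∷ map ty Γ) (ty A₂ ∷ Δ) (tld (var zero)) (ty A₁)
        dy = subst (⊢E _ _ (tld (var zero))) (dual-involutive (ty A₁)) (tld (ax zero))
    in lam (mu ⌊ wkTx q , tld (var zero) ⌋) , tσ₁ (Tr-wkx a) , lam (mu (cut (wkTx-typing _ dq) dy))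
  translate (S.inj₂ d) Δ =
    let (q , a , dq) = translate d Δ in lam (wkTx q) , tσ₂ (Tr-wkx a) , lam (wkTx-typing _ dq)
  translate {Γ = Γ} (S.lam {A = A} d) Δ =
    let (c , a , dc) = translate d Δ in
    bar (mut c) , tlam a , subst (⊢T (map ty Γ) Δ (bar (mut c))) (sym (ty-neg A)) (bar (mut dc))
  translate {Γ = Γ} (S.star {A = A} d e) Δ =
    let (p₁ , a₁ , d₁) = translate d Δ ; (p₂ , a₂ , d₂) = translate e Δ in
    ⌊ p₂ , tld p₁ ⌋ , tstar₁ a₁ a₂ ,
    cut d₂ (subst (⊢E (map ty Γ) Δ (tld p₁)) (trans (cong dual (ty-neg A)) (dual-involutive _)) (tld d₁))

open Translation using (translate; ty; AccR-from-SNT; AccR-from-SNC)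

corollary4p12 : LMM.AllTypableSN → Sym.AllTypableSN
corollary4p12 (snC , snT , _) Γ P (Sym.m A) d =
  let (t , tr , dt) = translate d [] in
  SN-from-logical d (AccR-from-SNT (accessible _ (snT (map ty Γ) [] t (ty A) dt)) tr)
corollary4p12 (snC , snT , _) Γ P Sym.bot d =
  let (c , tr , dc) = translate d [] in
  SN-from-logical d (AccR-from-SNC (accessible _ (snC (map ty Γ) [] c dc)) tr)
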